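{- Let $\mathcal{A}$ be a computable partial injection structure with bounded cycle character, bounded finite chain character, and no infinite orbits, and let $C$ be a cohesive set. Then $\mathcal{A}\cong\prod_C\mathcal{A}$.
   Context: A partial injection structure $(A,f)$ is a set $A$ with a partial function $f:A\to A$ that is one-to-one on its domain; it is viewed as the relational structure $(A,G_f)$ with $G_f=\{(x,y):x\in\mathrm{dom}(f),f(x)=y\}$, and it is computable if $A\subseteq\omega$ is computable, $f$ is partial computable and $G_f$ is computable. The orbit of $a$ is $\{b:\exists n\in\omega\,(f^n(a)\downarrow=b\vee f^n(b)\downarrow=a)\}$. A $k$-cycle is an orbit $\{x_1,\dots,x_k\}$ of distinct elements with $f(x_i)=x_{i+1}$ ($i<k$), $f(x_k)=x_1$; a $k$-chain is an orbit $\{x_1,\dots,x_k\}$ of distinct elements with $x_1\notin\mathrm{ran}(f)$, $x_{i+1}=f(x_i)$, $x_k\notin\mathrm{dom}(f)$. The cycle character (resp. finite chain character) is the set of $\langle k,n\rangle$, $k,n\ge1$, such that $\mathcal{A}$ has at least $n$ $k$-cycles (resp. $k$-chains); a character is bounded if there is an upper bound on such $k$. A set $C\subseteq\omega$ is cohesive if it is infinite and for every c.e. set $W$, one of $W\cap C$, $\overline{W}\cap C$ is finite; $X\subseteq^*Y$ means $X\setminus Y$ is finite. The cohesive power $\prod_C\mathcal{A}$ has as domain the partial computable functions $\psi:\omega\to A$ with $C\subseteq^*\mathrm{dom}(\psi)$, modulo $\psi_1=_C\psi_2$ iff $C\subseteq^*\{i:\psi_1(i)\downarrow=\psi_2(i)\downarrow\}$,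 with $G([\psi],[\varphi])$ iff $C\subseteq^*\{i:(\psi(i),\varphi(i))\in G_f\}$; it is again a partial injection structure. -}

module Defs where

open import Data.Nat using (ℕ; zero; suc; _<_; _≤_; _≥_; _∸_)
open import Data.Fin using (Fin)
open import Data.Vec using (Vec; []; _∷_; lookup)
open import Data.Product using (Σ; _×_; _,_; ∃)
open import Data.Sum using (_⊎_)
open import Data.Empty using (⊥)
open import Relation.Nullary using (¬_)
open import Relation.Binary.PropositionalEquality using (_≡_)

-- Model of computation: codes for partial (μ-)recursive functions with
-- a relational big-step semantics.  Eval e xs y  means  e(xs)↓ = y.

data PR : ℕ → Set where
  zeroF : ∀ {n} → PR n
  succF : PR 1
  projF : ∀ {n} → Fin n → PR n
  compF : ∀ {m n} → PR m → Vec (PR n) m → PR n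
  recF  : ∀ {n} → PR n → PR (suc (suc n)) → PR (suc n)
  muF   : ∀ {n} → PR (suc n) → PR n

mutual
  data Eval : ∀ {n} → PR n → Vec ℕ n → ℕ → Set where
    evZ  : ∀ {n} {xs : Vec ℕ n} → Eval zeroF xs 0
    evS  : ∀ {x} → Eval succF (x ∷ []) (suc x)
    evP  : ∀ {n} {i : Fin n} {xs} → Eval (projF i) xs (lookup xs i)
    evC  : ∀ {m n} {f : PR m} {gs : Vec (PR n) m} {xs ys y} →
           EvalAll gs xs ys → Eval f ys y → Eval (compF f gs) xs y
    evR0 : ∀ {n} {g : PR n} {h xs y} →
           Eval g xs y → Eval (recF g h) (0 ∷ xs) y
    evRs : ∀ {n} {g : PR n} {h xs k z y} →
           Eval (recF g h) (k ∷ xs) z → Eval h (k ∷ z ∷ xs) y →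
           Eval (recF g h) (suc k ∷ xs) y
    evM  : ∀ {n} {f : PR (suc n)} {xs y} →
           Eval f (y ∷ xs) 0 →
           (∀ z → z < y → Σ ℕ λ w → Eval f (z ∷ xs) (suc w)) →
           Eval (muF f) xs y

  data EvalAll {n} : ∀ {m} → Vec (PR n) m → Vec ℕ n → Vec ℕ m → Set where
    []  : ∀ {xs} → EvalAll [] xs []
    _∷_ : ∀ {m g y xs} {gs : Vec (PR n) m} {ys} →
          Eval g xs y → EvalAll gs xs ys → EvalAll (g ∷ gs) xs (y ∷ ys)

ComputableSet : (ℕ → Set) → Set
ComputableSet P = Σ (PR 1) λ e → ∀ x →
  (P x × Eval e (x ∷ []) 1) ⊎ (¬ P x × Eval e (x ∷ []) 0)

ComputableRel : (ℕ → ℕ → Set) → Set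
ComputableRel R = Σ (PR 2) λ e → ∀ x y →
  (R x y × Eval e (x ∷ y ∷ []) 1) ⊎ (¬ R x y × Eval e (x ∷ y ∷ []) 0)

-- c.e. set = domain of a unary partial computable function
Dom : PR 1 → ℕ → Set
Dom e x = ∃ λ y → Eval e (x ∷ []) y

Finite : (ℕ → Set) → Set
Finite X = Σ ℕ λ B → ∀ x → X x → x ≤ B

Infinite : (ℕ → Set) → Set
Infinite X = ∀ m → Σ ℕ λ x → x ≥ m × X x

_⊆*_ : (ℕ → Set) → (ℕ → Set) → Set
X ⊆* Y = Finite (λ x → X x × ¬ Y x)

Cohesive : (ℕ → Set) → Set
Cohesive C = Infinite C × (∀ (e : PR 1) →
  Finite (λ x → Dom e x × C x) ⊎ Finite (λ x → ¬ Dom e x × C x))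

-- Computable partial injection structures, viewed relationally (A , G_f)

record CompPIS : Set₁ where
  field
    A     : ℕ → Set
    G     : ℕ → ℕ → Set
    G⊆A   : ∀ x y → G x y → A x × A y
    G-fun : ∀ x y z → G x y → G x z → y ≡ z
    G-inj : ∀ x y z → G x z → G y z → x ≡ y
    A-comp : ComputableSet A
    G-comp : ComputableRel G
    f-pcomp : Σ (PR 1) λ e → ∀ x y → (Eval e (x ∷ []) y → G x y) × (G x y → Eval e (x ∷ []) y)

module _ (𝒜 : CompPIS) where
  open CompPIS 𝒜

  data Iter : ℕ → ℕ → ℕ → Set where
    it0 : ∀ {x} → Iter 0 x x
    itS : ∀ {n x y z} → G x y → Iter n y z → Iter (suc n) x z

  Orbit : ℕ → ℕ → Set
  Orbit a b = ∃ λ n → Iter n a b ⊎ Iter n b a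

  IsCycle : ℕ → ℕ → Set
  IsCycle k a = Σ (ℕ → ℕ) λ x →
      (k ≥ 1) × (x 0 ≡ a) × A a
    × (∀ i j → i < k → j < k → x i ≡ x j → i ≡ j)
    × (∀ i → suc i < k → G (x i) (x (suc i)))
    × G (x (k ∸ 1)) (x 0)
    × (∀ b → (Orbit a b → Σ ℕ λ i → i < k × x i ≡ b)
           × (Σ ℕ (λ i → i < k × x i ≡ b) → Orbit a b))

  IsChain : ℕ → ℕ → Set
  IsChain k a = Σ (ℕ → ℕ) λ x →
      (k ≥ 1) × (x 0 ≡ a) × A a
    × (∀ i j → i < k → j < k → x i ≡ x j → i ≡ j)
    × (¬ ∃ λ y → G y (x 0))
    × (∀ i → suc i < k → G (x i) (x (suc i)))
    × (¬ ∃ λ y → G (x (k ∸ 1)) y)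
    × (∀ b → (Orbit a b → Σ ℕ λ i → i < k × x i ≡ b)
           × (Σ ℕ (λ i → i < k × x i ≡ b) → Orbit a b))

  AtLeast : ℕ → (ℕ → Set) → Set
  AtLeast n P = Σ (Fin n → ℕ) λ r →
    (∀ i → P (r i)) × (∀ i j → Orbit (r i) (r j) → i ≡ j)

  -- ⟨k,n⟩ ∈ cycle character (pairs written as pairs of naturals)
  CycleChar : ℕ → ℕ → Set
  CycleChar k n = k ≥ 1 × n ≥ 1 × AtLeast n (IsCycle k)

  ChainChar : ℕ → ℕ → Set
  ChainChar k n = k ≥ 1 × n ≥ 1 × AtLeast n (IsChain k)

  BoundedChar : (ℕ → ℕ → Set) → Set
  BoundedChar χ = Σ ℕ λ B → ∀ k n → χ k n → k ≤ B

  NoInfiniteOrbits : Set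
  NoInfiniteOrbits = ∀ a → A a → Finite (Orbit a)

  -- Cohesive power ∏_C 𝒜 (as a setoid-presented relational structure)

  module Power (C : ℕ → Set) where
    record Elem : Set where
      field
        code   : PR 1
        ranA   : ∀ i y → Eval code (i ∷ []) y → A y
        domC   : C ⊆* Dom code

    open Elem

    _=C_ : Elem → Elem → Set
    ψ =C φ = C ⊆* (λ i → ∃ λ y → Eval (code ψ) (i ∷ []) y × Eval (code φ) (i ∷ []) y)

    GC : Elem → Elem → Set
    GC ψ φ = C ⊆* (λ i → Σ ℕ λ y → Σ ℕ λ z →
      Eval (code ψ) (i ∷ []) y × Eval (code φ) (i ∷ []) z × G y z)

    record Iso : Set where
      field
        h     : (a : ℕ) → A a → Elem
        h-inj : ∀ a b (pa : A a) (pb : A b) → h a pa =C h b pb → a ≡ b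
        h-sur : ∀ (ψ : Elem) → Σ ℕ λ a → Σ (A a) λ pa → h a pa =C ψ
        h-G   : ∀ a b (pa : A a) (pb : A b) →
                (G a b → GC (h a pa) (h b pb)) × (GC (h a pa) (h b pb) → G a b)

LEM : Set₁
LEM = (P : Set) → P ⊎ ¬ P

-- Every orbit of 𝒜 is a cycle or a chain with at most N elements, so the place of a point y in its orbit (shape and
-- index) is determined by its profile up to N: for which n ≤ N the iterate f^n(y) is defined, y lies in the range
-- of f^n, and f^(n+1)(y) = y. Each of these finitely many properties of ψ(i) is c.e. in i, so for an element ψ of
-- the power a cohesive C fixes all of them on almost all of C. Hence ψ = f^j(φ) for some j and some φ whose values
-- are almost everywhere starts of orbits of one shape τ, and it remains to match, shape by shape, the orbits of 𝒜
-- with those of the power. If 𝒜 has finitely many orbits of shape τ, their starts are bounded, so φ is almost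
-- bounded and, by cohesiveness again, almost constant: the constants are all the orbits of the power. If there are
-- infinitely many, both sides are countably infinite and are matched by enumerating each in increasing order, the
-- orbits of the power by the least codes of their elements.

module Submission where

open import Defs
open import Data.Empty using (⊥; ⊥-elim)
open import Data.Fin using (toℕ; fromℕ<) renaming (zero to fzero; suc to fsuc)
import Data.Fin.Properties as Finₚ
open import Data.Nat using (ℕ; zero; suc; _+_; _*_; _∸_; _<_; _≤_; _⊔_; z≤n; s≤s; pred; _<?_; _≤?_)
open import Data.Nat.Binary as ℕᵇ using (ℕᵇ; 2[1+_]; 1+[2_])
import Data.Nat.Binary.Properties as ℕᵇₚ
open import Data.Nat.DivMod using (_%_; _/_; m≡m%n+[m/n]*n; m%n<n)
open import Data.Nat.Properties
open import Algebra.Properties.CommutativeSemigroup +-commutativeSemigroup using (x∙yz≈y∙xz)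
open import Data.Product using (Σ; _×_; _,_; ∃; proj₁; proj₂)
open import Data.Sum using (_⊎_; inj₁; inj₂)
open import Data.Unit using (⊤; tt)
open import Data.Vec using (Vec; []; _∷_)
open import Function.Bundles using (_⇔_; Equivalence; mk⇔)
open import Relation.Binary.Definitions using (tri<; tri≈; tri>)
open import Relation.Binary.PropositionalEquality using (_≡_; refl; sym; trans; cong; cong₂; subst)
open import Relation.Nullary using (¬_; yes; no)

module Computation where

  mutual
    eval-functional : ∀ {n} {e : PR n} {xs y y′} → Eval e xs y → Eval e xs y′ → y ≡ y′
    eval-functional evZ evZ = refl
    eval-functional evS evS = refl
    eval-functional evP evP = refl
    eval-functional (evC as f) (evC as′ f′) with evalAll-functional as as′
    ... | refl = eval-functional f f′
    eval-functional (evR0 g) (evR0 g′) = eval-functional g g′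
    eval-functional (evRs r h) (evRs r′ h′) with eval-functional r r′
    ... | refl = eval-functional h h′
    eval-functional {y = y} {y′} (evM f0 below) (evM f0′ below′) with <-cmp y y′
    ... | tri≈ _ y≡y′ _ = y≡y′
    ... | tri< y<y′ _ _ with () ← eval-functional f0 (proj₂ (below′ y y<y′))
    ... | tri> _ _ y>y′ with () ← eval-functional f0′ (proj₂ (below y′ y>y′))

    evalAll-functional : ∀ {n m} {gs : Vec (PR n) m} {xs ys ys′} →
                         EvalAll gs xs ys → EvalAll gs xs ys′ → ys ≡ ys′
    evalAll-functional [] [] = refl
    evalAll-functional (e ∷ es) (e′ ∷ es′) = cong₂ _∷_ (eval-functional e e′) (evalAll-functional es es′)

  _∘ᵖ_ : PR 1 → PR 1 → PR 1
  g ∘ᵖ φ = compF g (φ ∷ [])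

  ∘ᵖ-eval : ∀ {g φ i x y} → Eval φ (i ∷ []) x → Eval g (x ∷ []) y → Eval (g ∘ᵖ φ) (i ∷ []) y
  ∘ᵖ-eval φi gx = evC (φi ∷ []) gx

  ∘ᵖ-eval⁻¹ : ∀ {g φ i y} → Eval (g ∘ᵖ φ) (i ∷ []) y → Σ ℕ λ x → Eval φ (i ∷ []) x × Eval g (x ∷ []) y
  ∘ᵖ-eval⁻¹ (evC (φi ∷ []) gx) = _ , φi , gx

  const : ℕ → PR 1
  const zero = zeroF
  const (suc c) = succF ∘ᵖ const c

  const-eval : ∀ c i → Eval (const c) (i ∷ []) c
  const-eval zero i = evZ
  const-eval (suc c) i = ∘ᵖ-eval (const-eval c i) evS

  const-eval⁻¹ : ∀ {c i y} → Eval (const c) (i ∷ []) y → y ≡ c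
  const-eval⁻¹ {c} {i} e = eval-functional e (const-eval c i)

  -- guard b i = 0 if b i = 0 and is undefined otherwise: a μ-search whose condition ignores the searched variable.
  guard : PR 1 → PR 1
  guard b = muF (compF b (projF (fsuc fzero) ∷ []))

  guard-eval : ∀ {b i} → Eval b (i ∷ []) 0 → Eval (guard b) (i ∷ []) 0
  guard-eval bi = evM (evC (evP ∷ []) bi) (λ _ ())

  guard-eval⁻¹ : ∀ {b i y} → Eval (guard b) (i ∷ []) y → Eval b (i ∷ []) 0
  guard-eval⁻¹ (evM (evC (evP ∷ []) bi) _) = bi

  isZero : PR 1
  isZero = recF (compF succF (zeroF ∷ [])) zeroF

  isZero-zero : Eval isZero (0 ∷ []) 1
  isZero-zero = evR0 (evC (evZ ∷ []) evS)

  isZero-suc : ∀ k → Eval isZero (suc k ∷ []) 0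
  isZero-suc zero = evRs isZero-zero evZ
  isZero-suc (suc k) = evRs (isZero-suc k) evZ

  predᵖ : PR 1
  predᵖ = recF zeroF (projF fzero)

  predᵖ-eval : ∀ x → Eval predᵖ (x ∷ []) (pred x)
  predᵖ-eval zero = evR0 evZ
  predᵖ-eval (suc x) = evRs (predᵖ-eval x) evP

  _∸ᵖ_ : PR 1 → ℕ → PR 1
  φ ∸ᵖ zero = φ
  φ ∸ᵖ suc c = predᵖ ∘ᵖ (φ ∸ᵖ c)

  ∸ᵖ-eval : ∀ c {φ i x} → Eval φ (i ∷ []) x → Eval (φ ∸ᵖ c) (i ∷ []) (x ∸ c)
  ∸ᵖ-eval zero φi = φi
  ∸ᵖ-eval (suc c) {x = x} φi =
    subst (Eval _ _) (pred[m∸n]≡m∸[1+n] x c) (∘ᵖ-eval (∸ᵖ-eval c φi) (predᵖ-eval (x ∸ c)))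

  ∸ᵖ-eval⁻¹ : ∀ c {φ i v} → Eval (φ ∸ᵖ c) (i ∷ []) v → Σ ℕ λ x → Eval φ (i ∷ []) x × v ≡ x ∸ c
  ∸ᵖ-eval⁻¹ zero φi = _ , φi , refl
  ∸ᵖ-eval⁻¹ (suc c) e with ∘ᵖ-eval⁻¹ e
  ... | _ , e₁ , e₂ with ∸ᵖ-eval⁻¹ c e₁
  ... | x , φi , refl = x , φi , trans (eval-functional e₂ (predᵖ-eval (x ∸ c))) (pred[m∸n]≡m∸[1+n] x c)

  atMost : ℕ → PR 1 → PR 1
  atMost c φ = guard (φ ∸ᵖ c)

  atMost-eval : ∀ c {φ i x} → Eval φ (i ∷ []) x → x ≤ c → Eval (atMost c φ) (i ∷ []) 0
  atMost-eval c φi x≤c = guard-eval (subst (Eval _ _) (m≤n⇒m∸n≡0 x≤c) (∸ᵖ-eval c φi))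

  atMost-eval⁻¹ : ∀ c {φ i y} → Eval (atMost c φ) (i ∷ []) y → Σ ℕ λ x → Eval φ (i ∷ []) x × x ≤ c
  atMost-eval⁻¹ c e with ∸ᵖ-eval⁻¹ c (guard-eval⁻¹ e)
  ... | x , φi , 0≡x∸c = x , φi , m∸n≡0⇒m≤n (sym 0≡x∸c)

module Coding where

  -- Programs are written as prefix-free bit streams into ℕᵇ (the bits 1 and 0 being prepended by 2[1+_] and
  -- 1+[2_]), numbers in unary as n ones followed by a zero.
  unary : ℕ → ℕᵇ → ℕᵇ
  unary zero s = 1+[2 s ]
  unary (suc n) s = 2[1+ unary n s ]

  unary-injective : ∀ {m n s t} → unary m s ≡ unary n t → m ≡ n × s ≡ t
  unary-injective {zero} {zero} refl = refl , refl
  unary-injective {suc m} {suc n} eq with unary-injective {m} {n} (ℕᵇₚ.2[1+_]-injective eq)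
  ... | refl , s≡t = refl , s≡t

  mutual
    serialise : ∀ {n} → PR n → ℕᵇ → ℕᵇ
    serialise zeroF s = unary 0 s
    serialise succF s = unary 1 s
    serialise (projF i) s = unary 2 (unary (toℕ i) s)
    serialise (compF {m} f gs) s = unary 3 (unary m (serialise f (serialiseAll gs s)))
    serialise (recF g h) s = unary 4 (serialise g (serialise h s))
    serialise (muF f) s = unary 5 (serialise f s)

    serialiseAll : ∀ {n m} → Vec (PR n) m → ℕᵇ → ℕᵇ
    serialiseAll [] s = s
    serialiseAll (g ∷ gs) s = serialise g (serialiseAll gs s)

  mutual
    serialise-injective : ∀ {n} (p q : PR n) {s t} → serialise p s ≡ serialise q t → p ≡ q × s ≡ t
    serialise-injective zeroF zeroF refl = refl , refl
    serialise-injective succF succF refl = refl , refl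
    serialise-injective (projF i) (projF j) eq with unary-injective {toℕ i} {toℕ j} (proj₂ (unary-injective eq))
    ... | i≡j , s≡t = cong projF (Finₚ.toℕ-injective i≡j) , s≡t
    serialise-injective (compF {m} f gs) (compF {m′} f′ gs′) eq
      with refl , eq′ ← unary-injective {m} {m′} (proj₂ (unary-injective eq))
      with refl , eq″ ← serialise-injective f f′ eq′
      with refl , s≡t ← serialiseAll-injective gs gs′ eq″ = refl , s≡t
    serialise-injective (recF g h) (recF g′ h′) eq
      with refl , eq′ ← serialise-injective g g′ (proj₂ (unary-injective eq))
      with refl , s≡t ← serialise-injective h h′ eq′ = refl , s≡t
    serialise-injective (muF f) (muF f′) eq
      with refl , s≡t ← serialise-injective f f′ (proj₂ (unary-injective eq)) = refl , s≡t

    serialiseAll-injective : ∀ {n m} (gs gs′ : Vec (PR n) m) {s t} →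
                             serialiseAll gs s ≡ serialiseAll gs′ t → gs ≡ gs′ × s ≡ t
    serialiseAll-injective [] [] eq = refl , eq
    serialiseAll-injective (g ∷ gs) (g′ ∷ gs′) eq
      with refl , eq′ ← serialise-injective g g′ eq
      with refl , s≡t ← serialiseAll-injective gs gs′ eq′ = refl , s≡t

  code : PR 1 → ℕ
  code p = ℕᵇ.toℕ (serialise p ℕᵇ.zero)

  code-injective : ∀ {p q} → code p ≡ code q → p ≡ q
  code-injective {p} {q} eq = proj₁ (serialise-injective p q (ℕᵇₚ.toℕ-injective eq))

module Classical (lem : LEM) where

  dne : ∀ {P : Set} → ¬ ¬ P → P
  dne {P} ¬¬p with lem P
  ... | inj₁ p = p
  ... | inj₂ ¬p = ⊥-elim (¬¬p ¬p)

  Least : (ℕ → Set) → ℕ → Set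
  Least P m = P m × (∀ x → P x → m ≤ x)

  private
    least-below : (P : ℕ → Set) → ∀ n → (∀ x → x < n → ¬ P x) ⊎ ∃ (Least P)
    least-below P zero = inj₁ (λ _ ())
    least-below P (suc n) with least-below P n
    ... | inj₂ m = inj₂ m
    ... | inj₁ none<n with lem (P n)
    ...   | inj₁ pn = inj₂ (n , pn , λ x px → ≮⇒≥ (λ x<n → none<n x x<n px))
    ...   | inj₂ ¬pn = inj₁ none≤n
      where
      none≤n : ∀ x → x < suc n → ¬ P x
      none≤n x x<1+n px with m<1+n⇒m<n∨m≡n x<1+n
      ... | inj₁ x<n = none<n x x<n px
      ... | inj₂ refl = ¬pn px

  least : (P : ℕ → Set) → ∀ {n} → P n → ∃ (Least P)
  least P {n} pn with least-below P (suc n)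
  ... | inj₁ none = ⊥-elim (none n (n<1+n n) pn)
  ... | inj₂ m = m

  ¬∀⇒∃¬ : ∀ {P : ℕ → Set} → ¬ (∀ n → P n) → ∃ λ n → ¬ P n
  ¬∀⇒∃¬ ¬∀ = dne (λ ¬∃ → ¬∀ (λ n → dne (λ ¬pn → ¬∃ (n , ¬pn))))

  ¬Finite⇒Infinite : ∀ {X : ℕ → Set} → ¬ Finite X → Infinite X
  ¬Finite⇒Infinite ¬fin m = dne (λ none≥m → ¬fin (m , λ x xx → <⇒≤ (≰⇒> (λ m≤x → none≥m (x , m≤x , xx)))))

  bounded⇒repeats : ∀ M (v : ℕ → ℕ) → (∀ t → v t ≤ M) → Σ ℕ λ t₁ → Σ ℕ λ t₂ → t₁ < t₂ × v t₁ ≡ v t₂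
  bounded⇒repeats M v v≤M with Finₚ.pigeonhole (n<1+n (suc M)) (λ i → fromℕ< (s≤s (v≤M (toℕ i))))
  ... | i , j , i<j , eq = toℕ i , toℕ j , i<j ,
        trans (sym (Finₚ.toℕ-fromℕ< _)) (trans (cong toℕ eq) (Finₚ.toℕ-fromℕ< _))

  injective⇒unbounded : (v : ℕ → ℕ) → (∀ {t t′} → v t ≡ v t′ → t ≡ t′) → ∀ m → Σ ℕ λ t → m ≤ v t
  injective⇒unbounded v v-inj m with lem (Σ ℕ λ t → m ≤ v t)
  ... | inj₁ t = t
  ... | inj₂ ¬t with bounded⇒repeats m v (λ t → <⇒≤ (≰⇒> (λ m≤vt → ¬t (t , m≤vt))))
  ... | t₁ , t₂ , t₁<t₂ , eq = ⊥-elim (<⇒≢ t₁<t₂ (v-inj eq))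

  ⊆*-mono : {C X Y : ℕ → Set} → (∀ i → C i → X i → Y i) → C ⊆* X → C ⊆* Y
  ⊆*-mono X⇒Y (B , bound) = B , λ i (ci , ¬yi) → bound i (ci , λ xi → ¬yi (X⇒Y i ci xi))

  ⊆*-∩ : {C X Y : ℕ → Set} → C ⊆* X → C ⊆* Y → C ⊆* (λ i → X i × Y i)
  ⊆*-∩ {X = X} (B₁ , bound₁) (B₂ , bound₂) = B₁ + B₂ , outside
    where
    outside : ∀ i → _ → i ≤ B₁ + B₂
    outside i (ci , ¬xy) with lem (X i)
    ... | inj₂ ¬x = m≤n⇒m≤n+o B₂ (bound₁ i (ci , ¬x))
    ... | inj₁ x = m≤n⇒m≤o+n B₁ (bound₂ i (ci , λ y → ¬xy (x , y)))

  ⊆⇒⊆* : {C X : ℕ → Set} → (∀ i → C i → X i) → C ⊆* X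
  ⊆⇒⊆* C⊆X = 0 , λ i (ci , ¬xi) → ⊥-elim (¬xi (C⊆X i ci))

  ⊆*-⋂ : ∀ {C : ℕ → Set} {X : ℕ → ℕ → Set} M → (∀ n → n ≤ M → C ⊆* X n) → C ⊆* (λ i → ∀ n → n ≤ M → X n i)
  ⊆*-⋂ {X = X} zero all = ⊆*-mono (λ i _ x n n≤0 → subst (λ n → X n i) (sym (n≤0⇒n≡0 n≤0)) x) (all 0 z≤n)
  ⊆*-⋂ {X = X} (suc M) all =
    ⊆*-mono extend (⊆*-∩ (⊆*-⋂ M (λ n n≤M → all n (m≤n⇒m≤1+n n≤M))) (all (suc M) ≤-refl))
    where
    extend : ∀ i → _ → (∀ n → n ≤ M → X n i) × X (suc M) i → ∀ n → n ≤ suc M → X n i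
    extend i _ (below , top) n n≤1+M with m≤n⇒m<n∨m≡n n≤1+M
    ... | inj₁ n<1+M = below n (≤-pred n<1+M)
    ... | inj₂ refl = top

  ⊆*-witness : {C X : ℕ → Set} → Infinite C → C ⊆* X → Σ ℕ λ i → C i × X i
  ⊆*-witness {X = X} infinite (B , bound) with infinite (suc B)
  ... | i , i>B , ci with lem (X i)
  ...   | inj₁ xi = i , ci , xi
  ...   | inj₂ ¬xi = ⊥-elim (<⇒≱ i>B (bound i (ci , ¬xi)))

  cohesive-split : {C : ℕ → Set} → Cohesive C → ∀ e → C ⊆* Dom e ⊎ C ⊆* (λ i → ¬ Dom e i)
  cohesive-split (_ , split) e with split e
  ... | inj₁ (B , bound) = inj₂ (B , λ i (ci , ¬¬d) → bound i (dne ¬¬d , ci))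
  ... | inj₂ (B , bound) = inj₁ (B , λ i (ci , ¬d) → bound i (¬d , ci))

  cohesive-settles : {C : ℕ → Set} → Cohesive C → ∀ e →
    Σ (ℕ → Set) λ U → C ⊆* U × (∀ {i i′} → U i → U i′ → Dom e i → Dom e i′)
  cohesive-settles coh e with cohesive-split coh e
  ... | inj₁ C⊆*dom = Dom e , C⊆*dom , λ _ d _ → d
  ... | inj₂ C⊆*¬dom = (λ i → ¬ Dom e i) , C⊆*¬dom , λ ¬d _ d → ⊥-elim (¬d d)

  module Enumeration (S : ℕ → Set) (infinite : Infinite S) where

    first : ∃ (Least S)
    first = least S (proj₂ (proj₂ (infinite 0)))

    next : ∀ x → ∃ (Least (λ m → S m × x < m))
    next x with infinite (suc x)
    ... | y , y>x , sy = least _ (sy , y>x)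

    enum : ℕ → ℕ
    enum zero = proj₁ first
    enum (suc t) = proj₁ (next (enum t))

    enum-∈ : ∀ t → S (enum t)
    enum-∈ zero = proj₁ (proj₂ first)
    enum-∈ (suc t) = proj₁ (proj₁ (proj₂ (next (enum t))))

    enum-<-suc : ∀ t → enum t < enum (suc t)
    enum-<-suc t = proj₂ (proj₁ (proj₂ (next (enum t))))

    enum-strictMono : ∀ {t t′} → t < t′ → enum t < enum t′
    enum-strictMono {t} {suc t′} t<1+t′ with m<1+n⇒m<n∨m≡n t<1+t′
    ... | inj₁ t<t′ = <-trans (enum-strictMono t<t′) (enum-<-suc t′)
    ... | inj₂ refl = enum-<-suc t

    enum-injective : ∀ {t t′} → enum t ≡ enum t′ → t ≡ t′
    enum-injective {t} {t′} eq with <-cmp t t′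
    ... | tri< t<t′ _ _ = ⊥-elim (<⇒≢ (enum-strictMono t<t′) eq)
    ... | tri≈ _ t≡t′ _ = t≡t′
    ... | tri> _ _ t>t′ = ⊥-elim (<⇒≢ (enum-strictMono t>t′) (sym eq))

    enum-≥ : ∀ t → t ≤ enum t
    enum-≥ zero = z≤n
    enum-≥ (suc t) = ≤-trans (s≤s (enum-≥ t)) (enum-<-suc t)

    -- The least t with x ≤ enum t has enum t = x, as no element of S lies strictly between enum (t ∸ 1) and enum t.
    enum-surjective : ∀ {x} → S x → Σ ℕ λ t → enum t ≡ x
    enum-surjective {x} sx with least (λ t → x ≤ enum t) {x} (enum-≥ x)
    ... | t , x≤enum-t , minimal with m≤n⇒m<n∨m≡n x≤enum-t
    ... | inj₂ x≡enum-t = t , sym x≡enum-t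
    ... | inj₁ x<enum-t = ⊥-elim (<⇒≱ x<enum-t (enum-≤ t minimal))
      where
      enum-≤ : ∀ t → (∀ t′ → x ≤ enum t′ → t ≤ t′) → enum t ≤ x
      enum-≤ zero _ = proj₂ (proj₂ first) x sx
      enum-≤ (suc t) minimal with lem (x ≤ enum t)
      ... | inj₁ x≤enum-t = ⊥-elim (1+n≰n (minimal t x≤enum-t))
      ... | inj₂ x≰enum-t = proj₂ (proj₂ (next (enum t))) x (sx , ≰⇒> x≰enum-t)

module Iteration (𝒜 : CompPIS) where

  open CompPIS 𝒜

  infix 4 _─[_]→_

  _─[_]→_ : ℕ → ℕ → ℕ → Set
  x ─[ n ]→ y = Iter 𝒜 n x y

  Forward Backward : ℕ → ℕ → Set
  Forward n y = ∃ λ z → y ─[ n ]→ z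
  Backward n y = ∃ λ z → z ─[ n ]→ y

  iter-cast : ∀ {m n x y} → m ≡ n → x ─[ m ]→ y → x ─[ n ]→ y
  iter-cast refl r = r

  iter-functional : ∀ {n x y y′} → x ─[ n ]→ y → x ─[ n ]→ y′ → y ≡ y′
  iter-functional it0 it0 = refl
  iter-functional (itS g r) (itS g′ r′) with refl ← G-fun _ _ _ g g′ = iter-functional r r′

  iter-zero : ∀ {x y} → x ─[ 0 ]→ y → x ≡ y
  iter-zero it0 = refl

  iter-++ : ∀ {m n x y z} → x ─[ m ]→ y → y ─[ n ]→ z → x ─[ m + n ]→ z
  iter-++ it0 r = r
  iter-++ (itS g r) r′ = itS g (iter-++ r r′)

  iter-split : ∀ m {n x z} → x ─[ m + n ]→ z → ∃ λ y → x ─[ m ]→ y × y ─[ n ]→ z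
  iter-split zero r = _ , it0 , r
  iter-split (suc m) (itS g r) with y , r₁ , r₂ ← iter-split m r = y , itS g r₁ , r₂

  iter-snoc : ∀ {n x y z} → x ─[ n ]→ y → G y z → x ─[ suc n ]→ z
  iter-snoc it0 g = itS g it0
  iter-snoc (itS g′ r) g = itS g′ (iter-snoc r g)

  iter-unsnoc : ∀ {n x z} → x ─[ suc n ]→ z → ∃ λ y → x ─[ n ]→ y × G y z
  iter-unsnoc {n} r with y , r₁ , itS g it0 ← iter-split n (iter-cast (+-comm 1 n) r) = y , r₁ , g

  iter-injective : ∀ {n x y z} → x ─[ n ]→ z → y ─[ n ]→ z → x ≡ y
  iter-injective it0 it0 = refl
  iter-injective {suc n} r r′
    with u , r₁ , g ← iter-unsnoc r
    with u′ , r₁′ , g′ ← iter-unsnoc r′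
    with refl ← G-inj _ _ _ g g′ = iter-injective r₁ r₁′

  iter-A : ∀ {n x y} → A x → x ─[ n ]→ y → A y
  iter-A ax it0 = ax
  iter-A ax (itS g r) = iter-A (proj₂ (G⊆A _ _ g)) r

  iter-A⁻ : ∀ {n x y} → A y → x ─[ n ]→ y → A x
  iter-A⁻ ay it0 = ay
  iter-A⁻ ay (itS g r) = proj₁ (G⊆A _ _ g)

  iter-pow : ∀ {p y} → y ─[ p ]→ y → ∀ t → y ─[ t * p ]→ y
  iter-pow r zero = it0
  iter-pow r (suc t) = iter-++ r (iter-pow r t)

  iter-prefix : ∀ {m n x z} → m ≤ n → x ─[ n ]→ z → Forward m x
  iter-prefix {m} m≤n r with o , refl ← m≤n⇒∃[o]m+o≡n m≤n with y , r₁ , _ ← iter-split m r = y , r₁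

  periodic⇒forward : ∀ {p y} → y ─[ suc p ]→ y → ∀ n → Forward n y
  periodic⇒forward {p} r n = iter-prefix (m≤m*n n (suc p)) (iter-pow r n)

  -- Going once more around the cycle through y leads from any w on it back to y.
  periodic-return : ∀ {p y i w} → y ─[ suc p ]→ y → y ─[ i ]→ w → ∃ λ r → w ─[ r ]→ y
  periodic-return {p} {i = i} ry ri
    with o , eq ← m≤n⇒∃[o]m+o≡n (≤-trans (n≤1+n i) (m≤m*n (suc i) (suc p)))
    with w , r₁ , r₂ ← iter-split i (iter-cast (sym eq) (iter-pow ry (suc i)))
    with refl ← iter-functional r₁ ri = o , r₂

  periodic-reach : ∀ {p y n b} → y ─[ suc p ]→ y → b ─[ n ]→ y → ∃ λ r → y ─[ r ]→ b
  periodic-reach {p} {n = n} ry rb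
    with o , eq ← m≤n⇒∃[o]m+o≡n (≤-trans (n≤1+n n) (m≤m*n (suc n) (suc p)))
    with b′ , r₁ , r₂ ← iter-split o (iter-cast (trans (sym eq) (+-comm n o)) (iter-pow ry (suc n)))
    with refl ← iter-injective r₂ rb = o , r₁

  period-transfer : ∀ {i r d y w} → y ─[ i ]→ w → w ─[ r ]→ y → w ─[ d ]→ w → y ─[ d ]→ y
  period-transfer {i} {r} {d} ri rr rw
    with y′ , r₁ , r₂ ← iter-split d (iter-cast (x∙yz≈y∙xz i d r) (iter-++ ri (iter-++ rw rr)))
    with refl ← iter-injective r₂ (iter-++ ri rr) = r₁

  -- As f is injective, a point from which a cycle is reached lies on it.
  reaches-cycle⇒periodic : ∀ {t a w d} → a ─[ t ]→ w → w ─[ suc d ]→ w → ∃ λ p → a ─[ suc p ]→ a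
  reaches-cycle⇒periodic {t} {d = d} ra rw
    with o , eq ← m≤n⇒∃[o]m+o≡n (m≤m*n (suc t) (suc d))
    with w′ , r₁ , r₂ ← iter-split (suc o)
                           (iter-cast (trans (sym eq) (trans (+-comm (suc t) o) (+-suc o t))) (iter-pow rw (suc t)))
    with refl ← iter-injective r₂ ra = t + o , iter-cast (+-suc t o) (iter-++ ra r₁)

  period-propagates : ∀ {d w t a} → w ─[ suc d ]→ w → w ─[ t ]→ a → a ─[ suc d ]→ a
  period-propagates rw rt with r , ra ← periodic-return rw rt = period-transfer ra rt rw

module Orbits (lem : LEM) (𝒜 : CompPIS) where

  open CompPIS 𝒜
  open Classical lem
  open Iteration 𝒜 public

  data Shape : Set where
    cycle chain : ℕ → Shape

  size : Shape → ℕ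
  size (cycle k) = suc k
  size (chain k) = suc k

  0<size : ∀ τ → 0 < size τ
  0<size (cycle _) = s≤s z≤n
  0<size (chain _) = s≤s z≤n

  record CycleStart (k s : ℕ) : Set where
    field
      in-A : A s
      period : s ─[ suc k ]→ s
      minimal : ∀ {m} → m < k → ¬ s ─[ suc m ]→ s

  record ChainStart (k s : ℕ) : Set where
    field
      in-A : A s
      no-pred : ¬ ∃ λ z → G z s
      end : ℕ
      to-end : s ─[ k ]→ end
      no-succ : ¬ ∃ (G end)

  -- Start τ s: s is element number 0 of an orbit of shape τ (every element of a cycle qualifies).
  Start : Shape → ℕ → Set
  Start (cycle k) = CycleStart k
  Start (chain k) = ChainStart k

  start-A : ∀ {τ s} → Start τ s → A s
  start-A {cycle _} = CycleStart.in-A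
  start-A {chain _} = ChainStart.in-A

  Normal : Shape → ℕ → ℕ → ℕ → Set
  Normal (cycle _) s j a = s ≡ a × j ≡ 0
  Normal (chain _) _ _ _ = ⊤

  record Position (a : ℕ) : Set where
    field
      shape : Shape
      start index : ℕ
      is-start : Start shape start
      index<size : index < size shape
      reaches : start ─[ index ]→ a
      normal : Normal shape start index a

  periodic-position : ∀ {a p} → A a → a ─[ suc p ]→ a → Position a
  periodic-position {a} aa ra with k , rk , least-k ← least (λ p → a ─[ suc p ]→ a) ra = record
    { shape = cycle k ; start = a ; index = 0
    ; is-start = record { in-A = aa ; period = rk ; minimal = λ m<k rm → <⇒≱ m<k (least-k _ rm) }
    ; index<size = s≤s z≤n ; reaches = it0 ; normal = refl , refl }

  -- s and e are the furthest points reachable backwards and forwards from a.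
  chain-position : ∀ {a} → A a → ¬ (∀ n → Backward n a) → ¬ (∀ n → Forward n a) → Position a
  chain-position {a} aa ¬bwd ¬fwd
    with least (λ n → ¬ Backward n a) (proj₂ (¬∀⇒∃¬ ¬bwd))
       | least (λ n → ¬ Forward n a) (proj₂ (¬∀⇒∃¬ ¬fwd))
  ... | zero , ¬b₀ , _ | _ = ⊥-elim (¬b₀ (a , it0))
  ... | suc j , _ , _ | zero , ¬f₀ , _ = ⊥-elim (¬f₀ (a , it0))
  ... | suc j , ¬bj , least-j | suc l , ¬fl , least-l
    with s , rs ← dne (λ ¬b → 1+n≰n (least-j j ¬b))
    with e , re ← dne (λ ¬f → 1+n≰n (least-l l ¬f)) = record
    { shape = chain (j + l) ; start = s ; index = j
    ; is-start = record
        { in-A = iter-A⁻ aa rs ; no-pred = λ (z , g) → ¬bj (z , itS g rs)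
        ; end = e ; to-end = iter-++ rs re ; no-succ = λ (z , g) → ¬fl (z , iter-snoc re g) }
    ; index<size = s≤s (m≤m+n j l) ; reaches = rs ; normal = tt }

  module _ (finite-orbits : NoInfiniteOrbits 𝒜) where

    forward-periodic : ∀ {a} → A a → (∀ n → Forward n a) → ∃ λ p → a ─[ suc p ]→ a
    forward-periodic {a} aa fwd
      with M , bound ← finite-orbits a aa
      with t₁ , t₂ , t₁<t₂ , eq ← bounded⇒repeats M (λ t → proj₁ (fwd t)) (λ t → bound _ (t , inj₁ (proj₂ (fwd t))))
      with d , refl ← m≤n⇒∃[o]m+o≡n t₁<t₂
      with w , r₁ , r₂ ← iter-split t₁ (iter-cast (sym (+-suc t₁ d)) (proj₂ (fwd (suc t₁ + d))))
      with refl ← iter-functional r₁ (proj₂ (fwd t₁))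
      = reaches-cycle⇒periodic r₁ (subst (λ z → proj₁ (fwd t₁) ─[ suc d ]→ z) (sym eq) r₂)

    backward-periodic : ∀ {a} → A a → (∀ n → Backward n a) → ∃ λ p → a ─[ suc p ]→ a
    backward-periodic {a} aa bwd
      with M , bound ← finite-orbits a aa
      with t₁ , t₂ , t₁<t₂ , eq ← bounded⇒repeats M (λ t → proj₁ (bwd t)) (λ t → bound _ (t , inj₂ (proj₂ (bwd t))))
      with d , refl ← m≤n⇒∃[o]m+o≡n t₁<t₂
      with w , r₁ , r₂ ← iter-split (suc d) (iter-cast (cong suc (+-comm t₁ d)) (proj₂ (bwd (suc t₁ + d))))
      with refl ← iter-injective r₂ (proj₂ (bwd t₁))
      = d , period-propagates (subst (λ z → z ─[ suc d ]→ proj₁ (bwd t₁)) (sym eq) r₁) r₂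

    classify : ∀ {a} → A a → Position a
    classify {a} aa with lem (∀ n → Forward n a)
    ... | inj₁ fwd = periodic-position aa (proj₂ (forward-periodic aa fwd))
    ... | inj₂ ¬fwd with lem (∀ n → Backward n a)
    ...   | inj₁ bwd = ⊥-elim (¬fwd (periodic⇒forward (proj₂ (backward-periodic aa bwd))))
    ...   | inj₂ ¬bwd = chain-position aa ¬bwd ¬fwd

  start-forward : ∀ {τ s i} → Start τ s → i < size τ → Forward i s
  start-forward {cycle k} st _ = periodic⇒forward (CycleStart.period st) _
  start-forward {chain k} st (s≤s i≤k) = iter-prefix i≤k (ChainStart.to-end st)

  chain-bounded : ∀ {k s n z} → ChainStart k s → k < n → s ─[ n ]→ z → ⊥
  chain-bounded {k} st k<n r
    with d , refl ← m≤n⇒∃[o]m+o≡n k<n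
    with e , r₁ , itS g _ ← iter-split k (iter-cast (sym (+-suc k d)) r)
    with refl ← iter-functional r₁ (ChainStart.to-end st) = ChainStart.no-succ st (_ , g)

  no-short-period : ∀ {τ s i d w} → Start τ s → s ─[ i ]→ w → suc d < size τ → w ─[ suc d ]→ w → ⊥
  no-short-period {chain k} {i = i} st ri _ rw with v , rv ← periodic⇒forward rw (suc k) =
    chain-bounded st (≤-trans (n<1+n k) (m≤n+m (suc k) i)) (iter-++ ri rv)
  no-short-period {cycle k} st ri (s≤s d<k) rw with r , rr ← periodic-return (CycleStart.period st) ri =
    CycleStart.minimal st d<k (period-transfer ri rr rw)

  no-return-within : ∀ {τ s i j w} → Start τ s → i < j → j < size τ → s ─[ i ]→ w → s ─[ j ]→ w → ⊥
  no-return-within {τ} {i = i} st i<j j<size ri rj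
    with d , refl ← m≤n⇒∃[o]m+o≡n i<j
    with u , r₁ , r₂ ← iter-split i (iter-cast (sym (+-suc i d)) rj)
    with refl ← iter-functional r₁ ri =
    no-short-period st ri (≤-<-trans (m≤n+m (suc d) i) (subst (_< size τ) (sym (+-suc i d)) j<size)) r₂

  start-iter-injective : ∀ {τ s i j w} → Start τ s → i < size τ → j < size τ → s ─[ i ]→ w → s ─[ j ]→ w → i ≡ j
  start-iter-injective {i = i} {j} st i<size j<size ri rj with <-cmp i j
  ... | tri< i<j _ _ = ⊥-elim (no-return-within st i<j j<size ri rj)
  ... | tri≈ _ i≡j _ = i≡j
  ... | tri> _ _ j<i = ⊥-elim (no-return-within st j<i i<size rj ri)

  cycle-reduce : ∀ {k s n b} → CycleStart k s → s ─[ n ]→ b → ∃ λ i → i < suc k × s ─[ i ]→ b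
  cycle-reduce {k} {s} {b = b} st rn with n₀ , r₀ , least-n₀ ← least (λ n → s ─[ n ]→ b) rn with n₀ <? suc k
  ... | yes n₀<size = n₀ , n₀<size , r₀
  ... | no n₀≮size
    with d , refl ← m≤n⇒∃[o]m+o≡n (≮⇒≥ n₀≮size)
    with u , r₁ , r₂ ← iter-split (suc k) r₀
    with refl ← iter-functional (CycleStart.period st) r₁ = ⊥-elim (<⇒≱ (m<n+m d (s≤s z≤n)) (least-n₀ d r₂))

  no-pred⇒iter-trivial : ∀ {d y y′} → ¬ (∃ λ z → G z y) → y′ ─[ d ]→ y → y′ ≡ y
  no-pred⇒iter-trivial _ it0 = refl
  no-pred⇒iter-trivial no-pred r@(itS _ _) with v , _ , g ← iter-unsnoc r = ⊥-elim (no-pred (v , g))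

  orbit-of-start : ∀ {τ s b} → Start τ s → Orbit 𝒜 s b → ∃ λ i → i < size τ × s ─[ i ]→ b
  orbit-of-start {cycle k} st (n , inj₁ r) = cycle-reduce st r
  orbit-of-start {cycle k} st (n , inj₂ r) = cycle-reduce st (proj₂ (periodic-reach (CycleStart.period st) r))
  orbit-of-start {chain k} st (n , inj₁ r) with n <? suc k
  ... | yes n<size = n , n<size , r
  ... | no n≮size = ⊥-elim (chain-bounded st (≮⇒≥ n≮size) r)
  orbit-of-start {chain k} st (n , inj₂ r) with refl ← no-pred⇒iter-trivial (ChainStart.no-pred st) r =
    0 , s≤s z≤n , it0

  cycleStart-propagates : ∀ {k s j y} → CycleStart k s → s ─[ j ]→ y → CycleStart k y
  cycleStart-propagates st rj with r , rr ← periodic-return (CycleStart.period st) rj = record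
    { in-A = iter-A in-A rj
    ; period = period-transfer rr rj period
    ; minimal = λ m<k rm → minimal m<k (period-transfer rj rr rm) }
    where open CycleStart st

  cycle-least-period : ∀ {k y m} → CycleStart k y → y ─[ suc m ]→ y → k ≤ m
  cycle-least-period {k} {m = m} st rm with k ≤? m
  ... | yes k≤m = k≤m
  ... | no k≰m = ⊥-elim (CycleStart.minimal st (≰⇒> k≰m) rm)

  chain-not-periodic : ∀ {k s j y m} → ChainStart k s → s ─[ j ]→ y → y ─[ suc m ]→ y → ⊥
  chain-not-periodic {k} {j = j} st rj rm with z , rz ← periodic⇒forward rm (suc k) =
    chain-bounded st (≤-trans (n<1+n k) (m≤n+m (suc k) j)) (iter-++ rj rz)

  chain-start-unique-≤ : ∀ {a b y y′ w} → a ≤ b → ¬ (∃ λ z → G z y) → y ─[ a ]→ w → y′ ─[ b ]→ w → y ≡ y′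
  chain-start-unique-≤ {a} a≤b no-pred ra rb
    with d , refl ← m≤n⇒∃[o]m+o≡n a≤b
    with u , r₁ , r₂ ← iter-split d (iter-cast (+-comm a d) rb)
    with refl ← iter-injective r₂ ra = sym (no-pred⇒iter-trivial no-pred r₁)

  chain-start-unique : ∀ {k k′ y y′ a b w} → ChainStart k y → ChainStart k′ y′ → y ─[ a ]→ w → y′ ─[ b ]→ w → y ≡ y′
  chain-start-unique {a = a} {b} st st′ ra rb with ≤-total a b
  ... | inj₁ a≤b = chain-start-unique-≤ a≤b (ChainStart.no-pred st) ra rb
  ... | inj₂ b≤a = sym (chain-start-unique-≤ b≤a (ChainStart.no-pred st′) rb ra)

  -- Going k * b more steps from w completes b rounds of the (k+1)-cycle from y′.
  cycle-return : ∀ {k y b w} → CycleStart k y → y ─[ b ]→ w → w ─[ k * b ]→ y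
  cycle-return {k} {b = b} st rb
    with u , r₁ , r₂ ← iter-split b (iter-cast (*-comm b (suc k)) (iter-pow (CycleStart.period st) b))
    with refl ← iter-functional r₁ rb = r₂

  start-shape-unique : ∀ {τ τ′ y y′ a b w} → Start τ y → Start τ′ y′ → y ─[ a ]→ w → y′ ─[ b ]→ w → τ ≡ τ′
  start-shape-unique {cycle k} {cycle k′} st st′ ra rb = cong cycle (≤-antisym
    (cycle-least-period st″ (CycleStart.period st′)) (cycle-least-period st′ (CycleStart.period st″)))
    where
    st″ : CycleStart k _
    st″ = cycleStart-propagates st (iter-++ ra (cycle-return st′ rb))
  start-shape-unique {cycle k} {chain k′} st st′ ra rb =
    ⊥-elim (chain-not-periodic st′ rb (CycleStart.period (cycleStart-propagates st ra)))
  start-shape-unique {chain k} {cycle k′} st st′ ra rb =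
    ⊥-elim (chain-not-periodic st ra (CycleStart.period (cycleStart-propagates st′ rb)))
  start-shape-unique {chain k} {chain k′} st st′ ra rb with refl ← chain-start-unique st st′ ra rb with <-cmp k k′
  ... | tri< k<k′ _ _ = ⊥-elim (chain-bounded st k<k′ (ChainStart.to-end st′))
  ... | tri≈ _ k≡k′ _ = cong chain k≡k′
  ... | tri> _ _ k′<k = ⊥-elim (chain-bounded st′ k′<k (ChainStart.to-end st))

module Characters (lem : LEM) (𝒜 : CompPIS) where

  open CompPIS 𝒜
  open Orbits lem 𝒜

  -- f^i(s) as a total function of i (with junk value 0 where f^i(s) is undefined).
  iterate : ℕ → ℕ → ℕ
  iterate s i with lem (Forward i s)
  ... | inj₁ (z , _) = z
  ... | inj₂ _ = 0

  iterate-iter : ∀ {s i} → Forward i s → s ─[ i ]→ iterate s i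
  iterate-iter {s} {i} fwd with lem (Forward i s)
  ... | inj₁ (_ , r) = r
  ... | inj₂ ¬fwd = ⊥-elim (¬fwd fwd)

  module _ {τ s} (st : Start τ s) where

    start-iterate : ∀ {i} → i < size τ → s ─[ i ]→ iterate s i
    start-iterate i<size = iterate-iter (start-forward st i<size)

    iterate-zero : iterate s 0 ≡ s
    iterate-zero = sym (iter-zero (start-iterate (0<size τ)))

    iterate-injective : ∀ i j → i < size τ → j < size τ → iterate s i ≡ iterate s j → i ≡ j
    iterate-injective i j i<size j<size eq =
      start-iter-injective st i<size j<size (start-iterate i<size)
        (subst (_ ─[ j ]→_) (sym eq) (start-iterate j<size))

    iterate-step : ∀ {i} → suc i < size τ → G (iterate s i) (iterate s (suc i))
    iterate-step {i} 1+i<size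
      with u , r , g ← iter-unsnoc (start-iterate 1+i<size)
      with refl ← iter-functional r (start-iterate (<-trans (n<1+n i) 1+i<size)) = g

    iterate-orbit : ∀ b → (Orbit 𝒜 s b → Σ ℕ λ i → i < size τ × iterate s i ≡ b)
                        × (Σ ℕ (λ i → i < size τ × iterate s i ≡ b) → Orbit 𝒜 s b)
    iterate-orbit b =
        (λ o → let i , i<size , r = orbit-of-start st o in i , i<size , iter-functional (start-iterate i<size) r)
      , (λ (i , i<size , eq) → i , inj₁ (subst (_ ─[ i ]→_) eq (start-iterate i<size)))

  cycleStart⇒IsCycle : ∀ {k s} → CycleStart k s → IsCycle 𝒜 (suc k) s
  cycleStart⇒IsCycle {k} {s} st =
    iterate s , s≤s z≤n , iterate-zero st , in-A , iterate-injective st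
    , (λ _ → iterate-step st) , closing , iterate-orbit st
    where
    open CycleStart st
    closing : G (iterate s k) (iterate s 0)
    closing
      with u , r , g ← iter-unsnoc period
      with refl ← iter-functional r (start-iterate st (n<1+n k)) = subst (G _) (sym (iterate-zero st)) g

  chainStart⇒IsChain : ∀ {k s} → ChainStart k s → IsChain 𝒜 (suc k) s
  chainStart⇒IsChain {k} {s} st =
    iterate s , s≤s z≤n , iterate-zero st , in-A , iterate-injective st
    , (λ (z , g) → no-pred (z , subst (G z) (iterate-zero st) g)) , (λ _ → iterate-step st)
    , (λ (z , g) → no-succ (z , subst (λ x → G x z) (iter-functional (start-iterate st (n<1+n k)) to-end) g))
    , iterate-orbit st
    where open ChainStart st

  module _ (cycles-bounded : BoundedChar 𝒜 (CycleChar 𝒜)) (chains-bounded : BoundedChar 𝒜 (ChainChar 𝒜)) where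

    sizeBound : ℕ
    sizeBound = proj₁ cycles-bounded + proj₁ chains-bounded

    one-orbit : ∀ {P : ℕ → Set} {s} → P s → AtLeast 𝒜 1 P
    one-orbit {s = s} ps = (λ _ → s) , (λ _ → ps) , λ { fzero fzero _ → refl }

    size≤sizeBound : ∀ {τ s} → Start τ s → size τ ≤ sizeBound
    size≤sizeBound {cycle k} st = m≤n⇒m≤n+o (proj₁ chains-bounded)
      (proj₂ cycles-bounded (suc k) 1 (s≤s z≤n , s≤s z≤n , one-orbit {IsCycle 𝒜 (suc k)} (cycleStart⇒IsCycle st)))
    size≤sizeBound {chain k} st = m≤n⇒m≤o+n (proj₁ cycles-bounded)
      (proj₂ chains-bounded (suc k) 1 (s≤s z≤n , s≤s z≤n , one-orbit {IsChain 𝒜 (suc k)} (chainStart⇒IsChain st)))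

module Profiles (lem : LEM) (𝒜 : CompPIS) where

  open CompPIS 𝒜
  open Orbits lem 𝒜

  chain-height : ∀ {k s j y n} → ChainStart k s → s ─[ j ]→ y → Backward n y → n ≤ j
  chain-height {j = j} {n = n} st rj (z , rz) with n ≤? j
  ... | yes n≤j = n≤j
  ... | no n≰j
    with d , refl ← m≤n⇒∃[o]m+o≡n (≰⇒> n≰j)
    with u , r₁ , r₂ ← iter-split (suc d) (iter-cast (cong suc (+-comm j d)) rz)
    with refl ← iter-injective r₂ rj
    with v , _ , g ← iter-unsnoc r₁ = ⊥-elim (ChainStart.no-pred st (v , g))

  chain-depth : ∀ {k s j y n} → ChainStart k s → s ─[ j ]→ y → Forward n y → j + n ≤ k
  chain-depth {k} {j = j} {n = n} st rj (z , rz) with j + n ≤? k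
  ... | yes j+n≤k = j+n≤k
  ... | no j+n≰k = ⊥-elim (chain-bounded st (≰⇒> j+n≰k) (iter-++ rj rz))

  chain-depth-attained : ∀ {k s j y} → ChainStart k s → s ─[ j ]→ y → j < suc k → Σ ℕ λ r → j + r ≡ k × Forward r y
  chain-depth-attained {j = j} st rj (s≤s j≤k)
    with r , eq ← m≤n⇒∃[o]m+o≡n j≤k
    with u , r₁ , r₂ ← iter-split j (iter-cast (sym eq) (ChainStart.to-end st))
    with refl ← iter-functional r₁ rj = r , eq , (ChainStart.end st , r₂)

  record SameProfile (N y₀ y : ℕ) : Set where
    field
      forward : ∀ {n} → n ≤ N → Forward n y₀ ⇔ Forward n y
      backward : ∀ {n} → n ≤ N → Backward n y₀ ⇔ Backward n y
      returns : ∀ {n} → n ≤ N → y₀ ─[ suc n ]→ y₀ ⇔ y ─[ suc n ]→ y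

  module _ {N} (size≤N : ∀ {τ s} → Start τ s → size τ ≤ N) where

    private
      index≤N : ∀ {y} (p : Position y) → Position.index p ≤ N
      index≤N p = ≤-trans (<⇒≤ (Position.index<size p)) (size≤N (Position.is-start p))

      depth≤N : ∀ {k s j d} → ChainStart k s → j + d ≡ k → d ≤ N
      depth≤N {j = j} st refl = ≤-trans (m≤n+m _ j) (<⇒≤ (size≤N st))

      period≤N : ∀ {k s} → CycleStart k s → k ≤ N
      period≤N st = <⇒≤ (size≤N st)

    -- On a chain the index of y is the largest n with y ∈ ran f^n, and the index of the end exceeds it by the largest
    -- n with f^n(y) defined; on a cycle the length is the least period.
    same-profile⇒same-position : ∀ {y₀ y} → SameProfile N y₀ y → (p₀ : Position y₀) → Position y →
                                 ∃ λ s → Start (Position.shape p₀) s × s ─[ Position.index p₀ ]→ y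
    same-profile⇒same-position {y₀} {y} same
      p₀@record { shape = chain k₀ ; start = s₀ ; index = j₀ ; is-start = st₀ ; index<size = j₀<size ; reaches = r₀ }
      p@record { shape = chain k ; start = s ; index = j ; is-start = st ; index<size = j<size ; reaches = r } =
      s , subst (λ k → ChainStart k s) k≡k₀ st , subst (λ j → s ─[ j ]→ y) j≡j₀ r
      where
      open SameProfile same
      j≡j₀ : j ≡ j₀
      j≡j₀ = ≤-antisym (chain-height st₀ r₀ (Equivalence.from (backward (index≤N p)) (s , r)))
                       (chain-height st r (Equivalence.to (backward (index≤N p₀)) (s₀ , r₀)))
      k≡k₀ : k ≡ k₀
      k≡k₀ with d , j+d≡k , fwd ← chain-depth-attained st r j<size
               | d₀ , j₀+d₀≡k₀ , fwd₀ ← chain-depth-attained st₀ r₀ j₀<size = ≤-antisym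
        (subst (_≤ k₀) (trans (cong (_+ d) (sym j≡j₀)) j+d≡k)
          (chain-depth st₀ r₀ (Equivalence.from (forward (depth≤N st j+d≡k)) fwd)))
        (subst (_≤ k) (trans (cong (_+ d₀) j≡j₀) j₀+d₀≡k₀)
          (chain-depth st r (Equivalence.to (forward (depth≤N st₀ j₀+d₀≡k₀)) fwd₀)))
    same-profile⇒same-position same
      record { shape = chain k₀ ; is-start = st₀ ; reaches = r₀ }
      record { shape = cycle k ; is-start = st ; normal = refl , refl } =
      ⊥-elim (chain-not-periodic st₀ r₀
        (Equivalence.from (SameProfile.returns same (period≤N st)) (CycleStart.period st)))
    same-profile⇒same-position same
      record { shape = cycle k₀ ; is-start = st₀ ; normal = refl , refl }
      record { shape = chain k ; is-start = st ; reaches = r } =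
      ⊥-elim (chain-not-periodic st r
        (Equivalence.to (SameProfile.returns same (period≤N st₀)) (CycleStart.period st₀)))
    same-profile⇒same-position {y = y} same
      record { shape = cycle k₀ ; is-start = st₀ ; normal = refl , refl }
      record { shape = cycle k ; is-start = st ; normal = refl , refl } =
      y , subst (λ k → CycleStart k y) k≡k₀ st , it0
      where
      open SameProfile same
      k≡k₀ : k ≡ k₀
      k≡k₀ = ≤-antisym (cycle-least-period st (Equivalence.to (returns (period≤N st₀)) (CycleStart.period st₀)))
                       (cycle-least-period st₀ (Equivalence.from (returns (period≤N st)) (CycleStart.period st)))

module Representatives (lem : LEM) (𝒜 : CompPIS) where

  open CompPIS 𝒜
  open Classical lem
  open Orbits lem 𝒜

  reduce : Shape → ℕ → ℕ
  reduce (cycle k) n = n % suc k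
  reduce (chain k) n = n

  reduce-iter : ∀ {τ y n w} → Start τ y → y ─[ n ]→ w → y ─[ reduce τ n ]→ w
  reduce-iter {chain k} st r = r
  reduce-iter {cycle k} {n = n} st r
    with u , r₁ , r₂ ← iter-split ((n / suc k) * suc k)
                         (iter-cast (trans (m≡m%n+[m/n]*n n (suc k)) (+-comm (n % suc k) _)) r)
    with refl ← iter-functional r₁ (iter-pow (CycleStart.period st) (n / suc k)) = r₂

  reduce<size : ∀ {τ y n} → Start τ y → Forward n y → reduce τ n < size τ
  reduce<size {cycle k} {n = n} _ _ = m%n<n n (suc k)
  reduce<size {chain k} {n = n} st (_ , r) with n <? suc k
  ... | yes n<size = n<size
  ... | no n≮size = ⊥-elim (chain-bounded st (≮⇒≥ n≮size) r)

  -- The index of y′ in the orbit of y, when w is reached from both in a and b steps.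
  offset : Shape → ℕ → ℕ → ℕ
  offset (cycle k) a b = reduce (cycle k) (a + k * b)
  offset (chain k) a b = 0

  offset<size : ∀ τ a b → offset τ a b < size τ
  offset<size (cycle k) a b = m%n<n (a + k * b) (suc k)
  offset<size (chain k) a b = s≤s z≤n

  offset-iter : ∀ {τ y y′ a b w} → Start τ y → Start τ y′ → y ─[ a ]→ w → y′ ─[ b ]→ w → y ─[ offset τ a b ]→ y′
  offset-iter {cycle k} st st′ ra rb = reduce-iter st (iter-++ ra (cycle-return st′ rb))
  offset-iter {chain k} st st′ ra rb with refl ← chain-start-unique st st′ ra rb = it0

  data Step : Shape → ℕ → ℕ → Set where
    next : ∀ {τ j} → suc j < size τ → Step τ j (suc j)
    wrap : ∀ {k} → Step (cycle k) k 0

  step-of : ∀ {τ y j j′ v} → Start τ y → j < size τ → j′ < size τ → y ─[ suc j ]→ v → y ─[ j′ ]→ v → Step τ j j′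
  step-of {τ} {j = j} st j<size j′<size r r′ with suc j <? size τ
  ... | yes 1+j<size with refl ← start-iter-injective st 1+j<size j′<size r r′ = next 1+j<size
  step-of {cycle k} {j = j} st (s≤s j≤k) j′<size r r′ | no 1+j≮size
    with refl ← ≤-antisym j≤k (≤-pred (≮⇒≥ 1+j≮size))
    with refl ← iter-functional r (CycleStart.period st)
    with refl ← start-iter-injective st j′<size (s≤s z≤n) r′ it0 = wrap
  step-of {chain k} st j<size _ r _ | no 1+j≮size = ⊥-elim (chain-bounded st (≮⇒≥ 1+j≮size) r)

  step-G : ∀ {τ y j j′ u v} → Start τ y → Step τ j j′ → y ─[ j ]→ u → y ─[ j′ ]→ v → G u v
  step-G st (next _) ru rv with u′ , r , g ← iter-unsnoc rv with refl ← iter-functional r ru = g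
  step-G st wrap ru it0 with u′ , r , g ← iter-unsnoc (CycleStart.period st) with refl ← iter-functional r ru = g

  LeastOnCycle : Shape → ℕ → Set
  LeastOnCycle (cycle k) r = ∀ m z → r ─[ m ]→ z → r ≤ z
  LeastOnCycle (chain k) r = ⊤

  record Representative (τ : Shape) (r : ℕ) : Set where
    field
      is-start : Start τ r
      least-on-cycle : LeastOnCycle τ r

  record Decomposition (a : ℕ) : Set where
    field
      shape : Shape
      rep index : ℕ
      is-rep : Representative shape rep
      index<size : index < size shape
      reaches : rep ─[ index ]→ a

  decompose : ∀ {a} → Position a → Decomposition a
  decompose record { shape = chain k ; start = s ; index = j ; is-start = st ; index<size = j<size ; reaches = r } =
    record { shape = chain k ; rep = s ; index = j ; is-rep = record { is-start = st ; least-on-cycle = tt }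
           ; index<size = j<size ; reaches = r }
  decompose {a} record { shape = cycle k ; start = s ; index = j ; is-start = st ; reaches = r }
    with r₀ , (m₀ , s→r₀) , least-r₀ ← least (λ z → ∃ λ m → s ─[ m ]→ z) {s} (0 , it0)
    with b , r₀→s ← periodic-return (CycleStart.period st) s→r₀ =
    record { shape = cycle k ; rep = r₀ ; index = reduce (cycle k) (b + j)
           ; is-rep = record { is-start = st₀
                             ; least-on-cycle = λ m z r₀→z → least-r₀ z (m₀ + m , iter-++ s→r₀ r₀→z) }
           ; index<size = m%n<n (b + j) (suc k) ; reaches = reduce-iter st₀ (iter-++ r₀→s r) }
    where
    st₀ : CycleStart k r₀
    st₀ = cycleStart-propagates st s→r₀

  representative-unique : ∀ {τ r r′ j j′ a} → Representative τ r → Representative τ r′ →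
                          r ─[ j ]→ a → r′ ─[ j′ ]→ a → r ≡ r′
  representative-unique {chain k} rr rr′ ra ra′ =
    chain-start-unique (Representative.is-start rr) (Representative.is-start rr′) ra ra′
  representative-unique {cycle k} rr rr′ ra ra′ = ≤-antisym
    (least-on-cycle rr _ _ (offset-iter (is-start rr) (is-start rr′) ra ra′))
    (least-on-cycle rr′ _ _ (offset-iter (is-start rr′) (is-start rr) ra′ ra))
    where open Representative

  decomposition-unique : ∀ {τ τ′ r r′ j j′ a} → Representative τ r → Representative τ′ r′ → j < size τ →
                         j′ < size τ′ →
                         r ─[ j ]→ a → r′ ─[ j′ ]→ a → Σ (τ ≡ τ′) λ { refl → r ≡ r′ × j ≡ j′ }
  decomposition-unique rr rr′ j<size j′<size ra ra′
    with refl ← start-shape-unique (Representative.is-start rr) (Representative.is-start rr′) ra ra′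
    with refl ← representative-unique rr rr′ ra ra′ =
    refl , refl , start-iter-injective (Representative.is-start rr) j<size j′<size ra ra′

module Programs (𝒜 : CompPIS) where

  open CompPIS 𝒜
  open Computation
  open Iteration 𝒜

  fᵖ : PR 1
  fᵖ = proj₁ f-pcomp

  fᵖ-eval : ∀ {x y} → G x y → Eval fᵖ (x ∷ []) y
  fᵖ-eval g = proj₂ (proj₂ f-pcomp _ _) g

  fᵖ-eval⁻¹ : ∀ {x y} → Eval fᵖ (x ∷ []) y → G x y
  fᵖ-eval⁻¹ e = proj₁ (proj₂ f-pcomp _ _) e

  notG : PR 2
  notG = compF isZero (proj₁ G-comp ∷ [])

  notG-eval : ∀ {x y} → G x y → Eval notG (x ∷ y ∷ []) 0
  notG-eval {x} {y} g with proj₂ G-comp x y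
  ... | inj₁ (_ , e) = evC (e ∷ []) (isZero-suc 0)
  ... | inj₂ (¬g , _) = ⊥-elim (¬g g)

  notG-eval-¬G : ∀ {x y} → ¬ G x y → Eval notG (x ∷ y ∷ []) 1
  notG-eval-¬G {x} {y} ¬g with proj₂ G-comp x y
  ... | inj₁ (g , _) = ⊥-elim (¬g g)
  ... | inj₂ (_ , e) = evC (e ∷ []) isZero-zero

  notG-eval⁻¹ : ∀ {x y} → Eval notG (x ∷ y ∷ []) 0 → G x y
  notG-eval⁻¹ {x} {y} (evC (e ∷ []) e₀) with proj₂ G-comp x y
  ... | inj₁ (g , _) = g
  ... | inj₂ (_ , e′) with refl ← eval-functional e e′ with () ← eval-functional e₀ isZero-zero

  iterᵖ : ℕ → PR 1 → PR 1
  iterᵖ zero φ = φ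
  iterᵖ (suc n) φ = iterᵖ n (fᵖ ∘ᵖ φ)

  iterᵖ-eval : ∀ n {φ i x y} → Eval φ (i ∷ []) x → x ─[ n ]→ y → Eval (iterᵖ n φ) (i ∷ []) y
  iterᵖ-eval zero φi it0 = φi
  iterᵖ-eval (suc n) φi (itS g r) = iterᵖ-eval n (∘ᵖ-eval φi (fᵖ-eval g)) r

  iterᵖ-eval⁻¹ : ∀ n {φ i y} → Eval (iterᵖ n φ) (i ∷ []) y → Σ ℕ λ x → Eval φ (i ∷ []) x × x ─[ n ]→ y
  iterᵖ-eval⁻¹ zero e = _ , e , it0
  iterᵖ-eval⁻¹ (suc n) e with w , fφi , r ← iterᵖ-eval⁻¹ n e with x , φi , fx ← ∘ᵖ-eval⁻¹ fφi =
    x , φi , itS (fᵖ-eval⁻¹ fx) r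

  iterᵖ-eval-from : ∀ n {φ i y v} → Eval φ (i ∷ []) y → Eval (iterᵖ n φ) (i ∷ []) v → y ─[ n ]→ v
  iterᵖ-eval-from n φi e with x , φi′ , r ← iterᵖ-eval⁻¹ n e with refl ← eval-functional φi′ φi = r

  iterᵖ-+ : ∀ a b {φ i y} → Eval (iterᵖ a (iterᵖ b φ)) (i ∷ []) y → Eval (iterᵖ (b + a) φ) (i ∷ []) y
  iterᵖ-+ a b e with w , e′ , r ← iterᵖ-eval⁻¹ a e with x , φi , r′ ← iterᵖ-eval⁻¹ b e′ =
    iterᵖ-eval (b + a) φi (iter-++ r′ r)

  -- f⁻¹(x) is found as the least y with G y x.
  f⁻¹ᵖ : PR 1
  f⁻¹ᵖ = muF notG

  f⁻¹ᵖ-eval : ∀ {x y} → G y x → Eval f⁻¹ᵖ (x ∷ []) y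
  f⁻¹ᵖ-eval {x} {y} g = evM (notG-eval g) below
    where
    below : ∀ z → z < y → Σ ℕ λ w → Eval notG (z ∷ x ∷ []) (suc w)
    below z z<y with proj₂ G-comp z x
    ... | inj₁ (gz , _) with refl ← G-inj _ _ _ gz g = ⊥-elim (<-irrefl refl z<y)
    below z z<y | inj₂ (¬gz , _) = 0 , notG-eval-¬G ¬gz

  f⁻¹ᵖ-eval⁻¹ : ∀ {x y} → Eval f⁻¹ᵖ (x ∷ []) y → G y x
  f⁻¹ᵖ-eval⁻¹ (evM e _) = notG-eval⁻¹ e

  iter⁻ᵖ : ℕ → PR 1 → PR 1
  iter⁻ᵖ zero φ = φ
  iter⁻ᵖ (suc n) φ = f⁻¹ᵖ ∘ᵖ iter⁻ᵖ n φ

  iter⁻ᵖ-eval : ∀ n {φ i x z} → Eval φ (i ∷ []) x → z ─[ n ]→ x → Eval (iter⁻ᵖ n φ) (i ∷ []) z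
  iter⁻ᵖ-eval zero φi it0 = φi
  iter⁻ᵖ-eval (suc n) φi (itS g r) = ∘ᵖ-eval (iter⁻ᵖ-eval n φi r) (f⁻¹ᵖ-eval g)

  iter⁻ᵖ-eval⁻¹ : ∀ n {φ i z} → Eval (iter⁻ᵖ n φ) (i ∷ []) z → Σ ℕ λ x → Eval φ (i ∷ []) x × z ─[ n ]→ x
  iter⁻ᵖ-eval⁻¹ zero e = _ , e , it0
  iter⁻ᵖ-eval⁻¹ (suc n) e with w , e′ , f⁻¹w ← ∘ᵖ-eval⁻¹ e with x , φi , r ← iter⁻ᵖ-eval⁻¹ n e′ =
    x , φi , itS (f⁻¹ᵖ-eval⁻¹ f⁻¹w) r

  iter⁻ᵖ-eval-from : ∀ n {φ i y v} → Eval φ (i ∷ []) y → Eval (iter⁻ᵖ n φ) (i ∷ []) v → v ─[ n ]→ y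
  iter⁻ᵖ-eval-from n φi e with x , φi′ , r ← iter⁻ᵖ-eval⁻¹ n e with refl ← eval-functional φi′ φi = r

  returnsᵖ : ℕ → PR 1 → PR 1
  returnsᵖ m φ = guard (compF notG (iterᵖ m φ ∷ φ ∷ []))

  returnsᵖ-eval : ∀ m {φ i y} → Eval φ (i ∷ []) y → y ─[ suc m ]→ y → Eval (returnsᵖ m φ) (i ∷ []) 0
  returnsᵖ-eval m φi r with w , r′ , g ← iter-unsnoc r = guard-eval (evC (iterᵖ-eval m φi r′ ∷ φi ∷ []) (notG-eval g))

  returnsᵖ-eval⁻¹ : ∀ m {φ i v} → Eval (returnsᵖ m φ) (i ∷ []) v → Σ ℕ λ y → Eval φ (i ∷ []) y × y ─[ suc m ]→ y
  returnsᵖ-eval⁻¹ m e with evC (e₁ ∷ φi ∷ []) e₂ ← guard-eval⁻¹ e with x , φi′ , r ← iterᵖ-eval⁻¹ m e₁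
    with refl ← eval-functional φi′ φi = x , φi , iter-snoc r (notG-eval⁻¹ e₂)

  returnsᵖ-eval-from : ∀ m {φ i y v} → Eval φ (i ∷ []) y → Eval (returnsᵖ m φ) (i ∷ []) v → y ─[ suc m ]→ y
  returnsᵖ-eval-from m φi e with x , φi′ , r ← returnsᵖ-eval⁻¹ m e with refl ← eval-functional φi′ φi = r

  RangeInA : PR 1 → Set
  RangeInA φ = ∀ i y → Eval φ (i ∷ []) y → A y

  iterᵖ-range : ∀ n {φ} → RangeInA φ → RangeInA (iterᵖ n φ)
  iterᵖ-range n φ⊆A i y e with x , φi , r ← iterᵖ-eval⁻¹ n e = iter-A (φ⊆A i x φi) r

  iter⁻ᵖ-range : ∀ n {φ} → RangeInA φ → RangeInA (iter⁻ᵖ n φ)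
  iter⁻ᵖ-range n φ⊆A i y e with x , φi , r ← iter⁻ᵖ-eval⁻¹ n e = iter-A⁻ (φ⊆A i x φi) r

  const-range : ∀ {c} → A c → RangeInA (const c)
  const-range ac i y e with refl ← const-eval⁻¹ e = ac

module CohesivePower (lem : LEM) (𝒜 : CompPIS) (C : ℕ → Set) (coh : Cohesive C) where

  open CompPIS 𝒜
  open Computation
  open Classical lem
  open Orbits lem 𝒜
  open Profiles lem 𝒜
  open Representatives lem 𝒜
  open Programs 𝒜

  infix 4 _≈_ _↦_

  _≈_ : PR 1 → PR 1 → Set
  φ ≈ ψ = C ⊆* (λ i → ∃ λ y → Eval φ (i ∷ []) y × Eval ψ (i ∷ []) y)

  _↦_ : PR 1 → PR 1 → Set
  φ ↦ ψ = C ⊆* (λ i → Σ ℕ λ y → Σ ℕ λ z → Eval φ (i ∷ []) y × Eval ψ (i ∷ []) z × G y z)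

  Total : PR 1 → Set
  Total φ = C ⊆* Dom φ

  witness : ∀ {X} → C ⊆* X → ∃ X
  witness C⊆*X with i , _ , xi ← ⊆*-witness (proj₁ coh) C⊆*X = i , xi

  ≈-refl : ∀ {φ} → Total φ → φ ≈ φ
  ≈-refl = ⊆*-mono (λ _ _ (y , φi) → y , φi , φi)

  ≈-sym : ∀ {φ ψ} → φ ≈ ψ → ψ ≈ φ
  ≈-sym = ⊆*-mono (λ _ _ (y , φi , ψi) → y , ψi , φi)

  ≈-trans : ∀ {φ ψ χ} → φ ≈ ψ → ψ ≈ χ → φ ≈ χ
  ≈-trans φ≈ψ ψ≈χ = ⊆*-mono glue (⊆*-∩ φ≈ψ ψ≈χ)
    where
    glue : ∀ i → C i → _ → ∃ λ y → Eval _ (i ∷ []) y × Eval _ (i ∷ []) y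
    glue _ _ ((y , φi , ψi) , (y′ , ψi′ , χi)) with refl ← eval-functional ψi ψi′ = y , φi , χi

  ≈⇒Total : ∀ {φ ψ} → φ ≈ ψ → Total φ
  ≈⇒Total = ⊆*-mono (λ _ _ (y , φi , _) → y , φi)

  Starts : Shape → PR 1 → Set
  Starts τ φ = C ⊆* (λ i → ∃ λ y → Eval φ (i ∷ []) y × Start τ y)

  Starts⇒Total : ∀ {τ φ} → Starts τ φ → Total φ
  Starts⇒Total = ⊆*-mono (λ _ _ (y , φi , _) → y , φi)

  const-Starts : ∀ {τ r} → Start τ r → Starts τ (const r)
  const-Starts {r = r} st = ⊆⇒⊆* (λ i _ → r , const-eval r i , st)

  iterᵖ-Total : ∀ {τ φ j} → Starts τ φ → j < size τ → Total (iterᵖ j φ)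
  iterᵖ-Total {j = j} φ-starts j<size = ⊆*-mono
    (λ _ _ (y , φi , st) → let z , r = start-forward st j<size in z , iterᵖ-eval j φi r) φ-starts

  iterᵖ-cong : ∀ {φ ψ m} → ψ ≈ iterᵖ m φ → ∀ j → Total (iterᵖ j ψ) → iterᵖ j ψ ≈ iterᵖ (m + j) φ
  iterᵖ-cong {m = m} ψ≈ j total = ⊆*-mono shift (⊆*-∩ ψ≈ total)
    where
    shift : ∀ i → C i → _ → ∃ λ y → Eval (iterᵖ j _) (i ∷ []) y × Eval (iterᵖ (m + j) _) (i ∷ []) y
    shift i _ ((y , ψi , mφi) , (z , jψi)) = z , jψi , iterᵖ-+ j m (iterᵖ-eval j mφi (iterᵖ-eval-from j ψi jψi))

  ↦⇒≈iterᵖ-suc : ∀ {φ ψ j} → iterᵖ j φ ↦ ψ → iterᵖ (suc j) φ ≈ ψ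
  ↦⇒≈iterᵖ-suc {j = j} = ⊆*-mono λ _ _ (y , z , jφi , ψi , g) →
    let x , φi , r = iterᵖ-eval⁻¹ j jφi in z , iterᵖ-eval (suc j) φi (iter-snoc r g) , ψi

  -- The orbit of a generic start φ of shape τ consists of the f^m φ with m < size τ.
  SameOrbit : Shape → PR 1 → PR 1 → Set
  SameOrbit τ φ ψ = ∃ λ m → m < size τ × ψ ≈ iterᵖ m φ

  sameOrbit : ∀ {τ φ ψ a b} → Starts τ φ → Starts τ ψ → iterᵖ a φ ≈ iterᵖ b ψ → SameOrbit τ φ ψ
  sameOrbit {τ} {φ} {ψ} {a} {b} φ-starts ψ-starts meet =
    offset τ a b , offset<size τ a b , ⊆*-mono at (⊆*-∩ φ-starts (⊆*-∩ ψ-starts meet))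
    where
    at : ∀ i → C i → _ → ∃ λ y → Eval ψ (i ∷ []) y × Eval (iterᵖ (offset τ a b) φ) (i ∷ []) y
    at i _ ((y , φi , st) , (y′ , ψi , st′) , (v , aφi , bψi)) =
      y′ , ψi , iterᵖ-eval (offset τ a b) φi
                  (offset-iter st st′ (iterᵖ-eval-from a φi aφi) (iterᵖ-eval-from b ψi bψi))

  sameOrbit-refl : ∀ {τ φ} → Starts τ φ → SameOrbit τ φ φ
  sameOrbit-refl φ-starts = sameOrbit {a = 0} {b = 0} φ-starts φ-starts (≈-refl (Starts⇒Total φ-starts))

  sameOrbit-sym : ∀ {τ φ ψ} → Starts τ φ → Starts τ ψ → SameOrbit τ φ ψ → SameOrbit τ ψ φ
  sameOrbit-sym φ-starts ψ-starts (m , _ , ψ≈) = sameOrbit {a = 0} {b = m} ψ-starts φ-starts ψ≈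

  sameOrbit-trans : ∀ {τ φ ψ χ} → Starts τ φ → Starts τ ψ → Starts τ χ →
                    SameOrbit τ φ ψ → SameOrbit τ ψ χ → SameOrbit τ φ χ
  sameOrbit-trans φ-starts ψ-starts χ-starts (m , _ , ψ≈) (m′ , m′<size , χ≈) =
    sameOrbit {a = m + m′} {b = 0} φ-starts χ-starts
      (≈-sym (≈-trans χ≈ (iterᵖ-cong {m = m} ψ≈ m′ (iterᵖ-Total ψ-starts m′<size))))

  ≈-shape : ∀ {τ τ′ φ φ′ a b} → Starts τ φ → Starts τ′ φ′ → iterᵖ a φ ≈ iterᵖ b φ′ → τ ≡ τ′
  ≈-shape {a = a} {b} φ-starts φ′-starts meet
    with _ , (y , φi , st) , (y′ , φ′i , st′) , (v , aφi , bφ′i) ← witness (⊆*-∩ φ-starts (⊆*-∩ φ′-starts meet)) =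
    start-shape-unique st st′ (iterᵖ-eval-from a φi aφi) (iterᵖ-eval-from b φ′i bφ′i)

  iterᵖ-≈-injective : ∀ {τ φ a b} → Starts τ φ → a < size τ → b < size τ → iterᵖ a φ ≈ iterᵖ b φ → a ≡ b
  iterᵖ-≈-injective {a = a} {b} φ-starts a<size b<size meet
    with _ , (y , φi , st) , (v , aφi , bφi) ← witness (⊆*-∩ φ-starts meet) =
    start-iter-injective st a<size b<size (iterᵖ-eval-from a φi aφi) (iterᵖ-eval-from b φi bφi)

  const-sameOrbit-injective : ∀ {τ r r′} → Representative τ r → Representative τ r′ →
                              SameOrbit τ (const r) (const r′) → r ≡ r′
  const-sameOrbit-injective {τ} {r} rr rr′ (m , m<size , r′≈)
    with _ , y , r′i , mri ← witness r′≈
    with refl ← const-eval⁻¹ r′i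
    with rm ← iterᵖ-eval-from m (const-eval r _) mri
    with refl , r≡r′ , _ ← decomposition-unique rr rr′ m<size (0<size τ) rm it0 = r≡r′

  ≈-reduce : ∀ {τ φ ψ n} → Starts τ φ → ψ ≈ iterᵖ n φ → reduce τ n < size τ × ψ ≈ iterᵖ (reduce τ n) φ
  ≈-reduce {τ} {φ} {ψ} {n} φ-starts ψ≈ = reduced<size , ⊆*-mono reduced (⊆*-∩ φ-starts ψ≈)
    where
    reduced : ∀ i → C i → _ → ∃ λ v → Eval ψ (i ∷ []) v × Eval (iterᵖ (reduce τ n) φ) (i ∷ []) v
    reduced i _ ((y , φi , st) , (v , ψi , nφi)) =
      v , ψi , iterᵖ-eval (reduce τ n) φi (reduce-iter st (iterᵖ-eval-from n φi nφi))
    reduced<size : reduce τ n < size τ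
    reduced<size with _ , (y , φi , st) , (v , ψi , nφi) ← witness (⊆*-∩ φ-starts ψ≈) =
      reduce<size st (v , iterᵖ-eval-from n φi nφi)

  ≈⇒Step : ∀ {τ φ j j′} → Starts τ φ → j < size τ → j′ < size τ → iterᵖ (suc j) φ ≈ iterᵖ j′ φ → Step τ j j′
  ≈⇒Step {j = j} {j′} φ-starts j<size j′<size meet
    with _ , (y , φi , st) , (v , e , e′) ← witness (⊆*-∩ φ-starts meet) =
    step-of st j<size j′<size (iterᵖ-eval-from (suc j) φi e) (iterᵖ-eval-from j′ φi e′)

  Step⇒↦ : ∀ {τ φ j j′} → Starts τ φ → j < size τ → j′ < size τ → Step τ j j′ → iterᵖ j φ ↦ iterᵖ j′ φ
  Step⇒↦ {j = j} {j′} φ-starts j<size j′<size step = ⊆*-mono at φ-starts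
    where
    at : ∀ i → C i → ∃ (λ y → Eval _ (i ∷ []) y × Start _ y) → Σ ℕ λ u → Σ ℕ λ v →
         Eval (iterᵖ j _) (i ∷ []) u × Eval (iterᵖ j′ _) (i ∷ []) v × G u v
    at i _ (y , φi , st) with u , ru ← start-forward st j<size with v , rv ← start-forward st j′<size =
      u , v , iterᵖ-eval j φi ru , iterᵖ-eval j′ φi rv , step-G st step ru rv

  -- c is the least bound that φ respects almost everywhere on C; by cohesiveness φ then almost never lies below it.
  almost-bounded⇒almost-constant : ∀ {φ} M → C ⊆* (λ i → ∃ λ y → Eval φ (i ∷ []) y × y ≤ M) →
                                   ∃ λ c → C ⊆* (λ i → Eval φ (i ∷ []) c)
  almost-bounded⇒almost-constant {φ} M bounded
    with least (λ c → C ⊆* Dom (atMost c φ)) (⊆*-mono (λ _ _ (y , φi , y≤M) → 0 , atMost-eval M φi y≤M) bounded)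
  ... | zero , ≤0 , _ = 0 , ⊆*-mono is-zero ≤0
    where
    is-zero : ∀ i → C i → Dom (atMost 0 φ) i → Eval φ (i ∷ []) 0
    is-zero i _ (_ , e) with x , φi , x≤0 ← atMost-eval⁻¹ 0 e with refl ← n≤0⇒n≡0 x≤0 = φi
  ... | suc c , ≤1+c , least-c with cohesive-split coh (atMost c φ)
  ...   | inj₁ ≤c = ⊥-elim (1+n≰n (least-c c ≤c))
  ...   | inj₂ ≰c = suc c , ⊆*-mono is-1+c (⊆*-∩ ≤1+c ≰c)
    where
    is-1+c : ∀ i → C i → Dom (atMost (suc c) φ) i × ¬ Dom (atMost c φ) i → Eval φ (i ∷ []) (suc c)
    is-1+c i _ ((_ , e) , ¬≤c) with x , φi , x≤1+c ← atMost-eval⁻¹ (suc c) e with m≤n⇒m<n∨m≡n x≤1+c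
    ... | inj₂ refl = φi
    ... | inj₁ x<1+c = ⊥-elim (¬≤c (0 , atMost-eval c φi (≤-pred x<1+c)))

  Settled : PR 1 → ℕ → Set
  Settled e = proj₁ (cohesive-settles coh e)

  C⊆*Settled : ∀ e → C ⊆* Settled e
  C⊆*Settled e = proj₁ (proj₂ (cohesive-settles coh e))

  settled-dom : ∀ e {i i′} → Settled e i → Settled e i′ → Dom e i → Dom e i′
  settled-dom e = proj₂ (proj₂ (cohesive-settles coh e))

  record PowerDecomposition (ψ : PR 1) : Set where
    field
      shape : Shape
      index : ℕ
      index<size : index < size shape
      starts : Starts shape (iter⁻ᵖ index ψ)
      ≈iter : ψ ≈ iterᵖ index (iter⁻ᵖ index ψ)

  module _ (finite-orbits : NoInfiniteOrbits 𝒜) {N} (size≤N : ∀ {τ s} → Start τ s → size τ ≤ N) where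

    -- On almost all of C cohesiveness fixes the profile up to N of ψ(i), hence its position in its orbit.
    decompose-power : ∀ ψ → RangeInA ψ → Total ψ → PowerDecomposition ψ
    decompose-power ψ ψ⊆A total = record
      { shape = τ₀ ; index = j₀ ; index<size = Position.index<size p₀
      ; starts = ⊆*-mono start-at typical
      ; ≈iter = ⊆*-mono back-and-forth typical }
      where
      SettledProfile : ℕ → Set
      SettledProfile i = ∀ n → n ≤ N → Settled (iterᵖ n ψ) i × Settled (iter⁻ᵖ n ψ) i × Settled (returnsᵖ n ψ) i

      typical : C ⊆* (λ i → SettledProfile i × Dom ψ i)
      typical = ⊆*-∩ (⊆*-⋂ N (λ n _ → ⊆*-∩ (C⊆*Settled _) (⊆*-∩ (C⊆*Settled _) (C⊆*Settled _)))) total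

      module _ {i i′ y y′} (S : SettledProfile i) (S′ : SettledProfile i′)
               (ψi : Eval ψ (i ∷ []) y) (ψi′ : Eval ψ (i′ ∷ []) y′) {n} (n≤N : n ≤ N) where

        forward-transfer : Forward n y → Forward n y′
        forward-transfer (z , r)
          with v , e ← settled-dom _ (proj₁ (S n n≤N)) (proj₁ (S′ n n≤N)) (z , iterᵖ-eval n ψi r) =
          v , iterᵖ-eval-from n ψi′ e

        backward-transfer : Backward n y → Backward n y′
        backward-transfer (z , r)
          with v , e ← settled-dom _ (proj₁ (proj₂ (S n n≤N))) (proj₁ (proj₂ (S′ n n≤N))) (z , iter⁻ᵖ-eval n ψi r) =
          v , iter⁻ᵖ-eval-from n ψi′ e

        returns-transfer : y ─[ suc n ]→ y → y′ ─[ suc n ]→ y′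
        returns-transfer r
          with _ , e ← settled-dom _ (proj₂ (proj₂ (S n n≤N))) (proj₂ (proj₂ (S′ n n≤N))) (0 , returnsᵖ-eval n ψi r) =
          returnsᵖ-eval-from n ψi′ e

      same-profile : ∀ {i i′ y y′} → SettledProfile i → SettledProfile i′ →
                     Eval ψ (i ∷ []) y → Eval ψ (i′ ∷ []) y′ → SameProfile N y y′
      same-profile S S′ ψi ψi′ = record
        { forward = λ n≤N → mk⇔ (forward-transfer S S′ ψi ψi′ n≤N) (forward-transfer S′ S ψi′ ψi n≤N)
        ; backward = λ n≤N → mk⇔ (backward-transfer S S′ ψi ψi′ n≤N) (backward-transfer S′ S ψi′ ψi n≤N)
        ; returns = λ n≤N → mk⇔ (returns-transfer S S′ ψi ψi′ n≤N) (returns-transfer S′ S ψi′ ψi n≤N) }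

      abstract
        w : ∃ λ i → SettledProfile i × Dom ψ i
        w = witness typical

        p₀ : Position (proj₁ (proj₂ (proj₂ w)))
        p₀ = classify finite-orbits (ψ⊆A _ _ (proj₂ (proj₂ (proj₂ w))))

      τ₀ : Shape
      τ₀ = Position.shape p₀

      j₀ : ℕ
      j₀ = Position.index p₀

      position : ∀ {i y} → SettledProfile i → Eval ψ (i ∷ []) y → ∃ λ s → Start τ₀ s × s ─[ j₀ ]→ y
      position S ψi = same-profile⇒same-position size≤N
        (same-profile (proj₁ (proj₂ w)) S (proj₂ (proj₂ (proj₂ w))) ψi) p₀ (classify finite-orbits (ψ⊆A _ _ ψi))

      start-at : ∀ i → C i → SettledProfile i × Dom ψ i → ∃ λ s → Eval (iter⁻ᵖ j₀ ψ) (i ∷ []) s × Start τ₀ s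
      start-at i _ (S , y , ψi) with s , st , r ← position S ψi = s , iter⁻ᵖ-eval j₀ ψi r , st

      back-and-forth : ∀ i → C i → SettledProfile i × Dom ψ i →
                       ∃ λ y → Eval ψ (i ∷ []) y × Eval (iterᵖ j₀ (iter⁻ᵖ j₀ ψ)) (i ∷ []) y
      back-and-forth i _ (S , y , ψi) with s , st , r ← position S ψi = y , ψi , iterᵖ-eval j₀ (iter⁻ᵖ-eval j₀ ψi r) r

module OrbitMatching (lem : LEM) (𝒜 : CompPIS) (C : ℕ → Set) (coh : Cohesive C) where

  open CompPIS 𝒜
  open Computation
  open Coding
  open Classical lem
  open Orbits lem 𝒜
  open Characters lem 𝒜
  open Representatives lem 𝒜
  open Programs 𝒜
  open CohesivePower lem 𝒜 C coh

  record Correspondence (τ : Shape) : Set where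
    field
      β : ℕ → PR 1
      β-range : ∀ {r} → Representative τ r → RangeInA (β r)
      β-starts : ∀ {r} → Representative τ r → Starts τ (β r)
      β-injective : ∀ {r r′} → Representative τ r → Representative τ r′ → SameOrbit τ (β r) (β r′) → r ≡ r′
      β-surjective : ∀ {φ} → RangeInA φ → Starts τ φ → ∃ λ r → Representative τ r × SameOrbit τ (β r) φ

  maxBelow : (ℕ → ℕ) → ℕ → ℕ
  maxBelow f zero = 0
  maxBelow f (suc n) = maxBelow f n ⊔ f n

  ≤-maxBelow : ∀ f {i n} → i < n → f i ≤ maxBelow f n
  ≤-maxBelow f {i} {suc n} i<1+n with m<1+n⇒m<n∨m≡n i<1+n
  ... | inj₁ i<n = ≤-trans (≤-maxBelow f i<n) (m≤m⊔n _ (f n))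
  ... | inj₂ refl = m≤n⊔m (maxBelow f n) (f n)

  module _ (decomposition : ∀ {a} → A a → Decomposition a) where

    decomposition-of-start : ∀ {τ s} → Start τ s → ∃ λ r → Representative τ r × ∃ λ j → j < size τ × r ─[ j ]→ s
    decomposition-of-start st with decomposition (start-A st)
    ... | record { rep = r ; index = j ; is-rep = rr ; index<size = j<size ; reaches = rj }
      with refl ← start-shape-unique (Representative.is-start rr) st rj it0 = r , rr , j , j<size , rj

    -- With finitely many orbits of shape τ, the starts are bounded, so every generic start is almost constant.
    finite-correspondence : ∀ τ → Finite (Representative τ) → Correspondence τ
    finite-correspondence τ (B , rep≤B) = record
      { β = const
      ; β-range = λ rr → const-range (start-A (Representative.is-start rr))
      ; β-starts = λ rr → const-Starts (Representative.is-start rr)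
      ; β-injective = const-sameOrbit-injective
      ; β-surjective = surjective }
      where
      M : ℕ
      M = maxBelow (λ r → maxBelow (iterate r) (size τ)) (suc B)

      start≤M : ∀ {y} → Start τ y → y ≤ M
      start≤M st with r , rr , j , j<size , rj ← decomposition-of-start st
        with refl ← iter-functional (start-iterate (Representative.is-start rr) j<size) rj =
        ≤-trans (≤-maxBelow (iterate r) j<size) (≤-maxBelow (λ r → maxBelow (iterate r) (size τ)) (s≤s (rep≤B r rr)))

      surjective : ∀ {φ} → RangeInA φ → Starts τ φ → ∃ λ r → Representative τ r × SameOrbit τ (const r) φ
      surjective {φ} _ φ-starts
        with c , φ≡c ← almost-bounded⇒almost-constant M (⊆*-mono (λ _ _ (y , φi , st) → y , φi , start≤M st) φ-starts)
        with i , φi≡c , y , φi , st ← witness (⊆*-∩ φ≡c φ-starts)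
        with refl ← eval-functional φi φi≡c
        with r , rr , j , j<size , rj ← decomposition-of-start st =
        r , rr , j , j<size , ⊆*-mono (λ i _ φi → y , φi , iterᵖ-eval j (const-eval r i) rj) φ≡c

  -- With infinitely many orbits of shape τ, both sides are enumerated in increasing order: the representatives in 𝒜,
  -- and the orbits of the power through their least codes.
  module Infinite (τ : Shape) (infinite : Infinite (Representative τ)) where

    IsCanonical : PR 1 → Set
    IsCanonical φ = RangeInA φ × Starts τ φ × (∀ {ψ} → RangeInA ψ → Starts τ ψ → SameOrbit τ φ ψ → code φ ≤ code ψ)

    Canonical : ℕ → Set
    Canonical n = Σ (PR 1) λ φ → IsCanonical φ × code φ ≡ n

    abstract
      canonical : ∀ {φ} → RangeInA φ → Starts τ φ → Σ (PR 1) λ φ₀ → SameOrbit τ φ φ₀ × IsCanonical φ₀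
      canonical {φ} φ⊆A φ-starts
        with n , (φ₀ , φ₀⊆A , φ₀-starts , φ~φ₀ , refl) , least-n ←
             least (λ n → Σ (PR 1) λ ψ → RangeInA ψ × Starts τ ψ × SameOrbit τ φ ψ × code ψ ≡ n)
                   (φ , φ⊆A , φ-starts , sameOrbit-refl φ-starts , refl) =
        φ₀ , φ~φ₀ , φ₀⊆A , φ₀-starts ,
        λ ψ⊆A ψ-starts φ₀~ψ →
          least-n _ (_ , ψ⊆A , ψ-starts , sameOrbit-trans φ-starts φ₀-starts ψ-starts φ~φ₀ φ₀~ψ , refl)

    module Reps = Enumeration (Representative τ) infinite

    const-rep : ℕ → PR 1
    const-rep t = const (Reps.enum t)

    const-rep-range : ∀ t → RangeInA (const-rep t)
    const-rep-range t = const-range (start-A (Representative.is-start (Reps.enum-∈ t)))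

    const-rep-starts : ∀ t → Starts τ (const-rep t)
    const-rep-starts t = const-Starts (Representative.is-start (Reps.enum-∈ t))

    canonical-rep : ℕ → PR 1
    canonical-rep t = proj₁ (canonical (const-rep-range t) (const-rep-starts t))

    rep~canonical-rep : ∀ t → SameOrbit τ (const-rep t) (canonical-rep t)
    rep~canonical-rep t = proj₁ (proj₂ (canonical (const-rep-range t) (const-rep-starts t)))

    canonical-rep-canonical : ∀ t → IsCanonical (canonical-rep t)
    canonical-rep-canonical t = proj₂ (proj₂ (canonical (const-rep-range t) (const-rep-starts t)))

    canonical-rep-injective : ∀ {t t′} → code (canonical-rep t) ≡ code (canonical-rep t′) → t ≡ t′
    canonical-rep-injective {t} {t′} eq =
      Reps.enum-injective (const-sameOrbit-injective (Reps.enum-∈ t) (Reps.enum-∈ t′)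
      (sameOrbit-trans (const-rep-starts t) t-starts (const-rep-starts t′) (rep~canonical-rep t)
        (sameOrbit-sym (const-rep-starts t′) t-starts
          (subst (SameOrbit τ (const-rep t′)) (sym (code-injective eq)) (rep~canonical-rep t′)))))
      where
      t-starts : Starts τ (canonical-rep t)
      t-starts = proj₁ (proj₂ (canonical-rep-canonical t))

    canonical-infinite : Infinite Canonical
    canonical-infinite m = code (canonical-rep t) , m≤ , canonical-rep t , canonical-rep-canonical t , refl
      where
      unbounded : Σ ℕ λ t → m ≤ code (canonical-rep t)
      unbounded = injective⇒unbounded (λ t → code (canonical-rep t)) canonical-rep-injective m
      t : ℕ
      t = proj₁ unbounded
      m≤ : m ≤ code (canonical-rep t)
      m≤ = proj₂ unbounded

    module Canonicals = Enumeration Canonical canonical-infinite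

    abstract
      index-of : ℕ → ℕ
      index-of r with lem (∃ λ t → Reps.enum t ≡ r)
      ... | inj₁ (t , _) = t
      ... | inj₂ _ = 0

      enum-index-of : ∀ {r} → Representative τ r → Reps.enum (index-of r) ≡ r
      enum-index-of {r} rr with lem (∃ λ t → Reps.enum t ≡ r)
      ... | inj₁ (_ , eq) = eq
      ... | inj₂ ¬found = ⊥-elim (¬found (Reps.enum-surjective rr))

      β : ℕ → PR 1
      β r = proj₁ (Canonicals.enum-∈ (index-of r))

      β-canonical : ∀ r → IsCanonical (β r)
      β-canonical r = proj₁ (proj₂ (Canonicals.enum-∈ (index-of r)))

      β-code : ∀ r → code (β r) ≡ Canonicals.enum (index-of r)
      β-code r = proj₂ (proj₂ (Canonicals.enum-∈ (index-of r)))

    β-range : ∀ r → RangeInA (β r)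
    β-range r = proj₁ (β-canonical r)

    β-starts : ∀ r → Starts τ (β r)
    β-starts r = proj₁ (proj₂ (β-canonical r))

    β-least : ∀ r {ψ} → RangeInA ψ → Starts τ ψ → SameOrbit τ (β r) ψ → code (β r) ≤ code ψ
    β-least r = proj₂ (proj₂ (β-canonical r))

    β-injective : ∀ {r r′} → Representative τ r → Representative τ r′ → SameOrbit τ (β r) (β r′) → r ≡ r′
    β-injective {r} {r′} rr rr′ r~r′ =
      trans (sym (enum-index-of rr))
        (trans (cong Reps.enum (Canonicals.enum-injective {index-of r} {index-of r′} same-code)) (enum-index-of rr′))
      where
      same-code : Canonicals.enum (index-of r) ≡ Canonicals.enum (index-of r′)
      same-code = trans (sym (β-code r)) (trans (≤-antisym
        (β-least r (β-range r′) (β-starts r′) r~r′)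
        (β-least r′ (β-range r) (β-starts r) (sameOrbit-sym (β-starts r) (β-starts r′) r~r′))) (β-code r′))

    β-surjective : ∀ {φ} → RangeInA φ → Starts τ φ → ∃ λ r → Representative τ r × SameOrbit τ (β r) φ
    β-surjective {φ} φ⊆A φ-starts = Reps.enum t , Reps.enum-∈ t , subst (λ ψ → SameOrbit τ ψ φ) (sym β≡φ₀) φ₀~φ
      where
      φ₀ : PR 1
      φ₀ = proj₁ (canonical φ⊆A φ-starts)
      φ₀-canonical : IsCanonical φ₀
      φ₀-canonical = proj₂ (proj₂ (canonical φ⊆A φ-starts))
      φ₀~φ : SameOrbit τ φ₀ φ
      φ₀~φ = sameOrbit-sym φ-starts (proj₁ (proj₂ φ₀-canonical)) (proj₁ (proj₂ (canonical φ⊆A φ-starts)))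
      position : Σ ℕ λ t → Canonicals.enum t ≡ code φ₀
      position = Canonicals.enum-surjective (φ₀ , φ₀-canonical , refl)
      t : ℕ
      t = proj₁ position
      index-of-enum : index-of (Reps.enum t) ≡ t
      index-of-enum = Reps.enum-injective (enum-index-of (Reps.enum-∈ t))
      β≡φ₀ : β (Reps.enum t) ≡ φ₀
      β≡φ₀ = code-injective (trans (β-code (Reps.enum t)) (trans (cong Canonicals.enum index-of-enum) (proj₂ position)))

    infinite-correspondence : Correspondence τ
    infinite-correspondence = record
      { β = β ; β-range = λ {r} _ → β-range r ; β-starts = λ {r} _ → β-starts r
      ; β-injective = β-injective ; β-surjective = β-surjective }

  correspondence : (∀ {a} → A a → Decomposition a) → ∀ τ → Correspondence τ
  correspondence decomposition τ with lem (Finite (Representative τ))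
  ... | inj₁ finite = finite-correspondence decomposition τ finite
  ... | inj₂ ¬finite = Infinite.infinite-correspondence τ (¬Finite⇒Infinite ¬finite)

module Isomorphism (lem : LEM) (𝒜 : CompPIS) (finite-orbits : NoInfiniteOrbits 𝒜)
  (cycles-bounded : BoundedChar 𝒜 (CycleChar 𝒜)) (chains-bounded : BoundedChar 𝒜 (ChainChar 𝒜))
  (C : ℕ → Set) (coh : Cohesive C) where

  open CompPIS 𝒜
  open Power 𝒜 C using (Elem)
  open Orbits lem 𝒜
  open Characters lem 𝒜
  open Representatives lem 𝒜
  open Programs 𝒜
  open CohesivePower lem 𝒜 C coh
  open OrbitMatching lem 𝒜 C coh using (Correspondence; correspondence)

  decomposition : ∀ {a} → A a → Decomposition a
  decomposition aa = decompose (classify finite-orbits aa)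

  open module Matching τ = Correspondence (correspondence decomposition τ)

  image : ∀ {a} → Decomposition a → PR 1
  image d = iterᵖ (Decomposition.index d) (β (Decomposition.shape d) (Decomposition.rep d))

  image-determined : ∀ {τ r j a} (d : Decomposition a) → Representative τ r → j < size τ → r ─[ j ]→ a →
                     image d ≡ iterᵖ j (β τ r)
  image-determined record { is-rep = rr′ ; index<size = j′<size ; reaches = rj′ } rr j<size rj
    with refl , refl , refl ← decomposition-unique rr′ rr j′<size j<size rj′ rj = refl

  image-injective : ∀ {a b} (d : Decomposition a) (d′ : Decomposition b) → image d ≈ image d′ → a ≡ b
  image-injective record { shape = τ ; index = j ; is-rep = rr ; index<size = j<size ; reaches = rj }
                  record { shape = τ′ ; index = j′ ; is-rep = rr′ ; index<size = j′<size ; reaches = rj′ } meet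
    with refl ← ≈-shape {a = j} {b = j′} (β-starts τ rr) (β-starts τ′ rr′) meet
    with refl ← β-injective τ rr rr′ (sameOrbit {a = j} {b = j′} (β-starts τ rr) (β-starts τ rr′) meet)
    with refl ← iterᵖ-≈-injective (β-starts τ rr) j<size j′<size meet = iter-functional rj rj′

  -- ψ ≈ f^j (f^-j ψ), where f^-j ψ lies in the orbit of some β r, which gives ψ ≈ f^n (β r) for some n.
  image-surjective : ∀ ψ → RangeInA ψ → Total ψ → ∃ λ a → Σ (A a) λ aa → image (decomposition aa) ≈ ψ
  image-surjective ψ ψ⊆A total =
    a , aa , ≈-sym (subst (ψ ≈_) (sym (image-determined (decomposition aa) rr n<size ra)) ψ≈f^n)
    where
    d : PowerDecomposition ψ
    d = decompose-power finite-orbits (size≤sizeBound cycles-bounded chains-bounded) ψ ψ⊆A total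
    open PowerDecomposition d
    found : ∃ λ r → Representative shape r × SameOrbit shape (β shape r) (iter⁻ᵖ index ψ)
    found = β-surjective shape (iter⁻ᵖ-range index ψ⊆A) starts
    r : ℕ
    r = proj₁ found
    rr : Representative shape r
    rr = proj₁ (proj₂ found)
    m : ℕ
    m = proj₁ (proj₂ (proj₂ found))
    reduced : reduce shape (m + index) < size shape × ψ ≈ iterᵖ (reduce shape (m + index)) (β shape r)
    reduced = ≈-reduce (β-starts shape rr) (≈-trans ≈iter
      (iterᵖ-cong {m = m} (proj₂ (proj₂ (proj₂ (proj₂ found)))) index (≈⇒Total (≈-sym ≈iter))))
    n<size : reduce shape (m + index) < size shape
    n<size = proj₁ reduced
    ψ≈f^n : ψ ≈ iterᵖ (reduce shape (m + index)) (β shape r)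
    ψ≈f^n = proj₂ reduced
    a : ℕ
    a = proj₁ (start-forward (Representative.is-start rr) n<size)
    ra : r ─[ reduce shape (m + index) ]→ a
    ra = proj₂ (start-forward (Representative.is-start rr) n<size)
    aa : A a
    aa = iter-A (start-A (Representative.is-start rr)) ra

  image-↦ : ∀ {a b} (d : Decomposition a) (d′ : Decomposition b) → G a b → image d ↦ image d′
  image-↦ {b = b}
    record { shape = τ ; rep = r ; index = j ; is-rep = rr ; index<size = j<size ; reaches = rj } d′ g =
    subst (iterᵖ j (β τ r) ↦_) (sym (image-determined d′ rr n<size rn))
      (Step⇒↦ (β-starts τ rr) j<size n<size (step-of st j<size n<size (iter-snoc rj g) rn))
    where
    st : Start τ r
    st = Representative.is-start rr
    n<size : reduce τ (suc j) < size τ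
    n<size = reduce<size st (b , iter-snoc rj g)
    rn : r ─[ reduce τ (suc j) ]→ b
    rn = reduce-iter st (iter-snoc rj g)

  image-↦⁻¹ : ∀ {a b} (d : Decomposition a) (d′ : Decomposition b) → image d ↦ image d′ → G a b
  image-↦⁻¹ record { shape = τ ; index = j ; is-rep = rr ; index<size = j<size ; reaches = rj }
            record { shape = τ′ ; index = j′ ; is-rep = rr′ ; index<size = j′<size ; reaches = rj′ } maps
    with meet ← ↦⇒≈iterᵖ-suc {j = j} maps
    with refl ← ≈-shape {a = suc j} {b = j′} (β-starts τ rr) (β-starts τ′ rr′) meet
    with refl ← β-injective τ rr rr′ (sameOrbit {a = suc j} {b = j′} (β-starts τ rr) (β-starts τ rr′) meet) =
    step-G (Representative.is-start rr) (≈⇒Step (β-starts τ rr) j<size j′<size meet) rj rj′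

  element : ∀ {a} → Decomposition a → Elem
  element d = record
    { code = image d
    ; ranA = iterᵖ-range (Decomposition.index d) (β-range _ (Decomposition.is-rep d))
    ; domC = iterᵖ-Total (β-starts _ (Decomposition.is-rep d)) (Decomposition.index<size d) }

mainTheorem17 : LEM → (𝒜 : CompPIS) → BoundedChar 𝒜 (CycleChar 𝒜) → BoundedChar 𝒜 (ChainChar 𝒜) → NoInfiniteOrbits 𝒜 → (C : ℕ → Set) → Cohesive C → Power.Iso 𝒜 C
mainTheorem17 lem 𝒜 cycles-bounded chains-bounded finite-orbits C coh = record
  { h = λ _ aa → element (decomposition aa)
  ; h-inj = λ _ _ aa ab → image-injective (decomposition aa) (decomposition ab)
  ; h-sur = λ ψ → image-surjective (Power.Elem.code ψ) (Power.Elem.ranA ψ) (Power.Elem.domC ψ)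
  ; h-G = λ _ _ aa ab → image-↦ (decomposition aa) (decomposition ab)
                      , image-↦⁻¹ (decomposition aa) (decomposition ab) }
  where open Isomorphism lem 𝒜 finite-orbits cycles-bounded chains-bounded C coh
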